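{- Let $q$ be a power of an odd prime, let $n\ge 2$, and let $\mathcal{S}\subseteq\mathbb{F}_q^n$ be a conical Kakeya set or a conical Nikodym set. Then $$|\mathcal{S}|\ge\left(\frac{q-1}{2n}\right)^n.$$
   Context: Fix a non-square $g\in\mathbb{F}_q^*$. For vectors $\underline{a},\underline{b},\underline{c}\in\mathbb{F}_q^n$ with $\underline{b},\underline{c}$ linearly independent, define: (H) a hyperbola $\mathcal{H}=\{\underline{a}+t\underline{b}+t^{ -1}\underline{c}: t\in\mathbb{F}_q^*\}$; (P) a parabola $\mathcal{P}=\{\underline{a}+t\underline{b}+t^{2}\underline{c}: t\in\mathbb{F}_q\}$; (E) an ellipse $\mathcal{E}=\{\underline{a}+x\underline{b}+y\underline{c}: (x,y)\in\mathbb{F}_q^2,\ y^2=gx^2+k\}$ for some $k\in\mathbb{F}_q^*$. A set $\mathcal{N}\subseteq\mathbb{F}_q^n$ is a conical Nikodym set if for every $\underline{x}\in\mathbb{F}_q^n$ there is a set $\mathcal{C}$ of one of the forms (H), (P), (E) with $\underline{x}\in\mathcal{C}$ and $\mathcal{C}\setminus\{\underline{x}\}\subseteq\mathcal{N}$. A set $\mathcal{K}\subseteq\mathbb{F}_q^n$ is a conical Kakeya set if for every $\underline{d}\in\mathbb{F}_q^n\setminus\{\underline{0}\}$ there exist $\underline{a},\underline{b},\underline{c}\in\mathbb{F}_q^n$ with $\underline{b},\underline{c}$ linearly independent such that either the hyperbola (H) with $\underline{d}\in\{\underline{b},\underline{c}\}$ is contained in $\mathcal{K}$, or the parabola (P)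 with $\underline{d}=\underline{c}$ is contained in $\mathcal{K}$. -}

module Defs where

open import Data.Nat using (ℕ; suc; _^_; _%_)
open import Data.Nat.Primality using (Prime)
open import Data.Fin using (Fin)
open import Data.Vec using (Vec; zipWith; map; replicate)
open import Data.Product using (Σ; ∃; ∃-syntax; _×_)
open import Data.Sum using (_⊎_)
open import Data.List using (List)
open import Data.List.Membership.Propositional using (_∈_)
open import Relation.Nullary using (¬_)
open import Relation.Binary.PropositionalEquality using (_≡_; _≢_)
open import Algebra.Structures using (IsCommutativeRing)
open import Function.Bundles using (_↔_)

OddPrimePower : ℕ → Set
OddPrimePower q = Σ ℕ λ p → Σ ℕ λ k → Prime p × (p % 2 ≡ 1) × (q ≡ p ^ suc k)

record FiniteField (q : ℕ) : Set₁ where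
  infixl 6 _+_
  infixl 7 _*_
  field
    Carrier : Set
    _+_ _*_ : Carrier → Carrier → Carrier
    -_      : Carrier → Carrier
    0# 1#   : Carrier
    isCommutativeRing : IsCommutativeRing _≡_ _+_ _*_ -_ 0# 1#
    0≢1     : 0# ≢ 1#
    inverse : ∀ x → x ≢ 0# → Σ Carrier λ y → x * y ≡ 1#
    size    : Carrier ↔ Fin q

module Geometry {q : ℕ} (F : FiniteField q) where
  open FiniteField F

  Pt : ℕ → Set
  Pt n = Vec Carrier n

  _⊕_ : ∀ {n} → Pt n → Pt n → Pt n
  _⊕_ = zipWith _+_

  _·_ : ∀ {n} → Carrier → Pt n → Pt n
  t · v = map (t *_) v

  𝟎 : ∀ {n} → Pt n
  𝟎 = replicate _ 0#

  LinIndep : ∀ {n} → Pt n → Pt n → Set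
  LinIndep b c = ∀ α β → (α · b) ⊕ (β · c) ≡ 𝟎 → (α ≡ 0#) × (β ≡ 0#)

  NonSquare : Carrier → Set
  NonSquare g = ∀ y → ¬ (y * y ≡ g)

  -- (H) x = a + t b + t⁻¹ c with t ∈ F*, written via s = t⁻¹ (t * s = 1)
  OnHyperbola : ∀ {n} → Pt n → Pt n → Pt n → Pt n → Set
  OnHyperbola a b c x = ∃[ t ] ∃[ s ] (t * s ≡ 1#) × (x ≡ (a ⊕ (t · b)) ⊕ (s · c))

  OnParabola : ∀ {n} → Pt n → Pt n → Pt n → Pt n → Set
  OnParabola a b c x = ∃[ t ] (x ≡ (a ⊕ (t · b)) ⊕ ((t * t) · c))

  OnEllipse : ∀ {n} → Carrier → Carrier → Pt n → Pt n → Pt n → Pt n → Set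
  OnEllipse g k a b c x =
    ∃[ u ] ∃[ v ] (v * v ≡ g * u * u + k) × (x ≡ (a ⊕ (u · b)) ⊕ (v · c))

  PuncturedIn : ∀ {n} → (Pt n → Set) → Pt n → List (Pt n) → Set
  PuncturedIn C x S = ∀ p → C p → p ≢ x → p ∈ S

  ContainedIn : ∀ {n} → (Pt n → Set) → List (Pt n) → Set
  ContainedIn C S = ∀ p → C p → p ∈ S

  ConicalNikodym : ∀ {n} → Carrier → List (Pt n) → Set
  ConicalNikodym {n} g S = ∀ (x : Pt n) → ∃[ a ] ∃[ b ] ∃[ c ] LinIndep b c ×
      (   (OnHyperbola a b c x × PuncturedIn (OnHyperbola a b c) x S)
        ⊎ (OnParabola a b c x × PuncturedIn (OnParabola a b c) x S)
        ⊎ (∃[ k ] (k ≢ 0#) × OnEllipse g k a b c x × PuncturedIn (OnEllipse g k a b c) x S))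

  ConicalKakeya : ∀ {n} → List (Pt n) → Set
  ConicalKakeya {n} S = ∀ (d : Pt n) → d ≢ 𝟎 → ∃[ a ] ∃[ b ] ∃[ c ] LinIndep b c ×
      (   (((d ≡ b) ⊎ (d ≡ c)) × ContainedIn (OnHyperbola a b c) S)
        ⊎ ((d ≡ c) × ContainedIn (OnParabola a b c) S))

-- If |S| < C(n + d, n), some nonzero polynomial P of degree ≤ d vanishes on S
-- (there are more coefficients than linear conditions); write it as a form in (w, y) homogeneous of
-- degree d.  Substituting a conic t ↦ A + t B + t² C, with w a quadratic in t, gives a polynomial
-- in t of degree ≤ 2d whose coefficient of t^(2d) is P(w₂, C).
-- Nikodym: the conic through x minus x lies in S, so this polynomial has at least q - 2 > 2d roots,
-- vanishes identically, and at the parameter of x gives P(x) = 0.  The ellipse is first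
-- parametrised by the slopes of the chords through x; as g is a non-square the denominator m² - g
-- never vanishes and the cleared parametrisation is a conic with leading coefficient x.
-- Kakeya: the leading coefficient says that the top-degree part of P vanishes in every direction,
-- so P and its lower part vanish on S alike, and induction on d makes P vanish everywhere.
-- In both cases P vanishes on all of F_q^n, hence P = 0 as d < q.  Taking q = 2d + 3,
-- C(n + d, n) ≥ (d + 1)^n / n! ≥ ((q - 1) / (2n))^n.

module Submission where

open import Defs

open import Algebra.Bundles using (CommutativeRing)
import Algebra.Properties.AbelianGroup as AbelianGroupProperties
import Algebra.Properties.CommutativeSemigroup as CommutativeSemigroupProperties
import Algebra.Properties.Group as GroupProperties
import Algebra.Properties.Ring as RingProperties
import Algebra.Properties.Semiring.Mult.TCOptimised as SemiringMult
import Algebra.Solver.Ring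
open import Algebra.Solver.Ring.AlmostCommutativeRing
  using (fromCommutativeRing; _-Raw-AlmostCommutative⟶_)
open import Data.Integer as ℤ using (ℤ; 0ℤ; 1ℤ; -[1+_]; _⊖_; _◃_)
import Data.Integer.Properties as ℤ
import Data.Sign as Sign
open import Data.Fin using (Fin; punchOut)
import Data.Fin.Properties as Fin
open import Data.List as List using (List; []; _∷_; _++_; length; tabulate; foldr)
import Data.List.Properties as List
open import Data.List.Membership.Propositional using (_∈_; _∉_)
open import Data.List.Relation.Unary.All as All using (All; []; _∷_)
import Data.List.Relation.Unary.All.Properties as All
open import Data.List.Relation.Unary.Any using (here; there)
open import Data.List.Relation.Unary.AllPairs using ([]; _∷_)
open import Data.List.Relation.Unary.Unique.Propositional using (Unique)
open import Data.List.Relation.Unary.Unique.Propositional.Properties using (tabulate⁺)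
open import Data.Maybe using (Maybe; just; nothing)
open import Data.Nat as ℕ using (ℕ; zero; suc; z≤n; s≤s; _≤_; _<_)
import Data.Nat.Properties as ℕ
open import Data.Vec as Vec using (Vec; []; _∷_)
import Data.Vec.Properties as Vec
open import Data.Vec.Relation.Unary.Any as Any using (here; there)
open import Data.Product using (Σ; ∃; _×_; _,_; proj₁; proj₂)
open import Data.Sum using (_⊎_; inj₁; inj₂; [_,_]′)
open import Data.Empty using (⊥-elim)
open import Relation.Nullary using (¬_; Dec; yes; no)
open import Function.Base using (_∘_)
open import Function.Bundles using (Inverse)
import Relation.Binary.PropositionalEquality as ≡
import Relation.Binary.Reasoning.Setoid as SetoidReasoning

-- Coefficient arithmetic happens in ℤ, so normal forms compute even when the carrier is abstract.
module ℤ-RingSolver {c ℓ} (R : CommutativeRing c ℓ) where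

  open CommutativeRing R
  open SemiringMult semiring renaming (_×_ to _×ᴿ_) using (1+×; ×-homo-+; ×1-homo-*)
  open GroupProperties +-group using (ε⁻¹≈ε; ⁻¹-involutive)
  open AbelianGroupProperties +-abelianGroup using (⁻¹-∙-comm)
  open CommutativeSemigroupProperties +-commutativeSemigroup using (interchange)
  open RingProperties ring using (-‿distribˡ-*; -‿distribʳ-*)
  open SetoidReasoning setoid

  fromℤ : ℤ → Carrier
  fromℤ (ℤ.+ n)    = n ×ᴿ 1#
  fromℤ -[1+ n ] = - (suc n ×ᴿ 1#)

  fromℤ-neg : ∀ i → fromℤ (ℤ.- i) ≈ - fromℤ i
  fromℤ-neg (ℤ.+ zero)  = sym ε⁻¹≈ε
  fromℤ-neg (ℤ.+ suc n) = refl
  fromℤ-neg -[1+ n ]  = sym (⁻¹-involutive _)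

  private
    1+x-[1+y]≈x-y : ∀ x y → (1# + x) - (1# + y) ≈ x - y
    1+x-[1+y]≈x-y x y = begin
      (1# + x) + - (1# + y)     ≈⟨ +-congˡ (⁻¹-∙-comm 1# y) ⟨
      (1# + x) + (- 1# + - y)   ≈⟨ interchange 1# x (- 1#) (- y) ⟩
      (1# + - 1#) + (x + - y)   ≈⟨ +-congʳ (-‿inverseʳ 1#) ⟩
      0# + (x + - y)            ≈⟨ +-identityˡ _ ⟩
      x - y                     ∎

  fromℤ-⊖ : ∀ m n → fromℤ (m ⊖ n) ≈ m ×ᴿ 1# - n ×ᴿ 1#
  fromℤ-⊖ zero    zero    = sym (trans (+-congˡ ε⁻¹≈ε) (+-identityˡ 0#))
  fromℤ-⊖ zero    (suc n) = sym (+-identityˡ _)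
  fromℤ-⊖ (suc m) zero    = sym (trans (+-congˡ ε⁻¹≈ε) (+-identityʳ _))
  fromℤ-⊖ (suc m) (suc n) = begin
    fromℤ (suc m ⊖ suc n)              ≡⟨ ≡.cong fromℤ (ℤ.[1+m]⊖[1+n]≡m⊖n m n) ⟩
    fromℤ (m ⊖ n)                      ≈⟨ fromℤ-⊖ m n ⟩
    m ×ᴿ 1# - n ×ᴿ 1#                  ≈⟨ 1+x-[1+y]≈x-y (m ×ᴿ 1#) (n ×ᴿ 1#) ⟨
    (1# + m ×ᴿ 1#) - (1# + n ×ᴿ 1#)    ≈⟨ +-cong (1+× m 1#) (-‿cong (1+× n 1#)) ⟨
    suc m ×ᴿ 1# - suc n ×ᴿ 1#          ∎

  fromℤ-+ : ∀ i j → fromℤ (i ℤ.+ j) ≈ fromℤ i + fromℤ j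
  fromℤ-+ (ℤ.+ m)    (ℤ.+ n)    = ×-homo-+ 1# m n
  fromℤ-+ (ℤ.+ m)    -[1+ n ] = fromℤ-⊖ m (suc n)
  fromℤ-+ -[1+ m ] (ℤ.+ n)    = trans (fromℤ-⊖ n (suc m)) (+-comm _ _)
  fromℤ-+ -[1+ m ] -[1+ n ] = begin
    - (suc (suc (m ℕ.+ n)) ×ᴿ 1#)         ≡⟨ ≡.cong (λ k → - (suc k ×ᴿ 1#)) (ℕ.+-suc m n) ⟨
    - ((suc m ℕ.+ suc n) ×ᴿ 1#)           ≈⟨ -‿cong (×-homo-+ 1# (suc m) (suc n)) ⟩
    - (suc m ×ᴿ 1# + suc n ×ᴿ 1#)         ≈⟨ ⁻¹-∙-comm _ _ ⟨
    - (suc m ×ᴿ 1#) + - (suc n ×ᴿ 1#)     ∎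

  fromSign : Sign.Sign → Carrier
  fromSign Sign.+ = 1#
  fromSign Sign.- = - 1#

  fromSign-* : ∀ s t → fromSign (s Sign.* t) ≈ fromSign s * fromSign t
  fromSign-* Sign.+ t      = sym (*-identityˡ _)
  fromSign-* Sign.- Sign.+ = sym (*-identityʳ _)
  fromSign-* Sign.- Sign.- = begin
    1#              ≈⟨ ⁻¹-involutive _ ⟨
    - - 1#          ≈⟨ -‿cong (*-identityʳ _) ⟨
    - (- 1# * 1#)   ≈⟨ -‿distribʳ-* _ _ ⟩
    - 1# * - 1#     ∎

  fromℤ-◃ : ∀ s n → fromℤ (s ◃ n) ≈ fromSign s * (n ×ᴿ 1#)
  fromℤ-◃ s      zero    = sym (zeroʳ _)
  fromℤ-◃ Sign.+ (suc n) = sym (*-identityˡ _)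
  fromℤ-◃ Sign.- (suc n) = trans (-‿cong (sym (*-identityˡ _))) (-‿distribˡ-* _ _)

  fromℤ-* : ∀ i j → fromℤ (i ℤ.* j) ≈ fromℤ i * fromℤ j
  fromℤ-* i j = begin
    fromℤ (i ℤ.* j)
      ≈⟨ fromℤ-◃ (s Sign.* t) (m ℕ.* n) ⟩
    fromSign (s Sign.* t) * ((m ℕ.* n) ×ᴿ 1#)
      ≈⟨ *-cong (fromSign-* s t) (×1-homo-* m n) ⟩
    (fromSign s * fromSign t) * (M * N)
      ≈⟨ interchange* (fromSign s) (fromSign t) M N ⟩
    (fromSign s * M) * (fromSign t * N)
      ≈⟨ *-cong (fromℤ-◃ s m) (fromℤ-◃ t n) ⟨
    fromℤ (s ◃ m) * fromℤ (t ◃ n)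
      ≡⟨ ≡.cong₂ (λ a b → fromℤ a * fromℤ b) (ℤ.◃-inverse i) (ℤ.◃-inverse j) ⟩
    fromℤ i * fromℤ j                          ∎
    where
    s = ℤ.sign i
    t = ℤ.sign j
    m = ℤ.∣ i ∣
    n = ℤ.∣ j ∣
    M = m ×ᴿ 1#
    N = n ×ᴿ 1#
    interchange* = CommutativeSemigroupProperties.interchange *-commutativeSemigroup

  homomorphism : ℤ.+-*-rawRing -Raw-AlmostCommutative⟶ fromCommutativeRing R
  homomorphism = record
    { ⟦_⟧ = fromℤ ; +-homo = fromℤ-+ ; *-homo = fromℤ-* ; -‿homo = fromℤ-neg
    ; 0-homo = refl ; 1-homo = refl }

  fromℤ-≡? : ∀ i j → Maybe (fromℤ i ≈ fromℤ j)
  fromℤ-≡? i j with i ℤ.≟ j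
  ... | yes i≡j = just (reflexive (≡.cong fromℤ i≡j))
  ... | no _    = nothing

  open Algebra.Solver.Ring ℤ.+-*-rawRing (fromCommutativeRing R) homomorphism fromℤ-≡? public

open ≡ using (_≡_; _≢_; refl; sym; trans; cong; cong₂; subst; subst₂; module ≡-Reasoning)

missing-value⇒¬injective : ∀ {m} (f : Fin m → Fin m) (j : Fin m) → (∀ i → f i ≢ j) →
                           ¬ (∀ {i k} → f i ≡ f k → i ≡ k)
missing-value⇒¬injective {suc m} f j f≢j f-injective =
  ℕ.<-irrefl refl (Fin.injective⇒≤ {f = f′} f′-injective)
  where
  j≢f : ∀ i → j ≢ f i
  j≢f i = f≢j i ∘ sym
  f′ : Fin (suc m) → Fin m
  f′ i = punchOut (j≢f i)
  f′-injective : ∀ {i k} → f′ i ≡ f′ k → i ≡ k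
  f′-injective {i} {k} = f-injective ∘ Fin.punchOut-injective (j≢f i) (j≢f k)

module Field {q : ℕ} (F : FiniteField q) where

  open FiniteField F public

  commutativeRing : CommutativeRing _ _
  commutativeRing = record { isCommutativeRing = isCommutativeRing }

  open CommutativeRing commutativeRing public
    using (+-assoc; +-comm; *-assoc; *-comm; +-identityˡ; +-identityʳ; *-identityˡ; *-identityʳ
          ; _-_; -‿inverseʳ; zeroˡ; zeroʳ)
  open GroupProperties (CommutativeRing.+-group commutativeRing) public
    using () renaming (x∙y⁻¹≈ε⇒x≈y to x-y≡0⇒x≡y; identityʳ-unique to x+y≡x⇒y≡0)
  open ℤ-RingSolver commutativeRing public using (solve; _:=_; _:+_; _:*_; _:-_; :-_; con)
  open ≡-Reasoning

  toFin : Carrier → Fin q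
  toFin = Inverse.to size

  fromFin : Fin q → Carrier
  fromFin = Inverse.from size

  toFin-injective : ∀ {x y} → toFin x ≡ toFin y → x ≡ y
  toFin-injective e =
    trans (sym (Inverse.inverseʳ size refl)) (trans (cong fromFin e) (Inverse.inverseʳ size refl))

  fromFin-injective : ∀ {i j} → fromFin i ≡ fromFin j → i ≡ j
  fromFin-injective e =
    trans (sym (Inverse.inverseˡ size refl)) (trans (cong toFin e) (Inverse.inverseˡ size refl))

  infix 4 _≟_
  _≟_ : (x y : Carrier) → Dec (x ≡ y)
  x ≟ y with toFin x Fin.≟ toFin y
  ... | yes e = yes (toFin-injective e)
  ... | no ne = no (ne ∘ cong toFin)

  x*y≡0⇒x≡0⊎y≡0 : ∀ x y → x * y ≡ 0# → x ≡ 0# ⊎ y ≡ 0#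
  x*y≡0⇒x≡0⊎y≡0 x y xy≡0 with x ≟ 0#
  ... | yes x≡0 = inj₁ x≡0
  ... | no x≢0  = inj₂ (begin
    y
      ≡⟨ solve 3 (λ x x⁻¹ y → y := (con 1ℤ :- x :* x⁻¹) :* y :+ x⁻¹ :* (x :* y)) refl x x⁻¹ y ⟩
    (1# - x * x⁻¹) * y + x⁻¹ * (x * y)
      ≡⟨ cong₂ (λ a b → (1# - a) * y + x⁻¹ * b) x*x⁻¹≡1 xy≡0 ⟩
    (1# - 1#) * y + x⁻¹ * 0#
      ≡⟨ solve 2 (λ x⁻¹ y → (con 1ℤ :- con 1ℤ) :* y :+ x⁻¹ :* con 0ℤ := con 0ℤ) refl x⁻¹ y ⟩
    0#               ∎)
    where
    x⁻¹ = proj₁ (inverse x x≢0)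
    x*x⁻¹≡1 = proj₂ (inverse x x≢0)

  x≢0∧y≢0⇒x*y≢0 : ∀ {x y} → x ≢ 0# → y ≢ 0# → x * y ≢ 0#
  x≢0∧y≢0⇒x*y≢0 x≢0 y≢0 xy≡0 with x*y≡0⇒x≡0⊎y≡0 _ _ xy≡0
  ... | inj₁ x≡0 = x≢0 x≡0
  ... | inj₂ y≡0 = y≢0 y≡0

  infixr 8 _^_
  _^_ : Carrier → ℕ → Carrier
  x ^ zero  = 1#
  x ^ suc n = x * x ^ n

  x≢0⇒x^n≢0 : ∀ {x} n → x ≢ 0# → x ^ n ≢ 0#
  x≢0⇒x^n≢0 zero    x≢0 = 0≢1 ∘ sym
  x≢0⇒x^n≢0 (suc n) x≢0 = x≢0∧y≢0⇒x*y≢0 x≢0 (x≢0⇒x^n≢0 n x≢0)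

  1^n≡1 : ∀ n → 1# ^ n ≡ 1#
  1^n≡1 zero    = refl
  1^n≡1 (suc n) = trans (*-identityˡ _) (1^n≡1 n)

  [x*y]^n≡x^n*y^n : ∀ x y n → (x * y) ^ n ≡ x ^ n * y ^ n
  [x*y]^n≡x^n*y^n x y zero    = sym (*-identityˡ 1#)
  [x*y]^n≡x^n*y^n x y (suc n) = trans (cong ((x * y) *_) ([x*y]^n≡x^n*y^n x y n))
    (solve 4 (λ x y a b → (x :* y) :* (a :* b) := (x :* a) :* (y :* b)) refl x y (x ^ n) (y ^ n))

  square-injective-if-2≡0 : 1# + 1# ≡ 0# → ∀ {x y} → x * x ≡ y * y → x ≡ y
  square-injective-if-2≡0 2≡0 {x} {y} x²≡y² with x*y≡0⇒x≡0⊎y≡0 (x - y) (x - y) (begin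
    (x - y) * (x - y)
      ≡⟨ solve 2 (λ x y → (x :- y) :* (x :- y) :=
        (x :* x :- y :* y) :+ (con 1ℤ :+ con 1ℤ) :* (y :* y :- x :* y)) refl x y ⟩
    (x * x - y * y) + (1# + 1#) * (y * y - x * y)
      ≡⟨ cong₂ (λ a b → (a - y * y) + b * (y * y - x * y)) x²≡y² 2≡0 ⟩
    (y * y - y * y) + 0# * (y * y - x * y)
      ≡⟨ solve 2 (λ x y → (y :* y :- y :* y) :+ con 0ℤ :* (y :* y :- x :* y) := con 0ℤ) refl x y ⟩
    0#                                      ∎)
  ... | inj₁ x-y≡0 = x-y≡0⇒x≡y x y x-y≡0
  ... | inj₂ x-y≡0 = x-y≡0⇒x≡y x y x-y≡0

  nonSquare⇒≢0 : ∀ {g} → (∀ y → y * y ≢ g) → g ≢ 0#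
  nonSquare⇒≢0 g-nonSquare g≡0 = g-nonSquare 0# (trans (zeroˡ 0#) (sym g≡0))

  -- In characteristic 2 squaring is injective, hence onto the finite field.
  nonSquare⇒2≢0 : ∀ {g} → (∀ y → y * y ≢ g) → 1# + 1# ≢ 0#
  nonSquare⇒2≢0 {g} g-nonSquare 2≡0 = missing-value⇒¬injective square (toFin g) square≢g square-injective
    where
    square : Fin q → Fin q
    square i = toFin (fromFin i * fromFin i)
    square≢g : ∀ i → square i ≢ toFin g
    square≢g i = g-nonSquare (fromFin i) ∘ toFin-injective
    square-injective : ∀ {i j} → square i ≡ square j → i ≡ j
    square-injective = fromFin-injective ∘ square-injective-if-2≡0 2≡0 ∘ toFin-injective

  elements : List Carrier
  elements = tabulate fromFin

  elements-unique : Unique elements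
  elements-unique = tabulate⁺ fromFin-injective

  length-elements : length elements ≡ q
  length-elements = List.length-tabulate fromFin

  remove : Carrier → List Carrier → List Carrier
  remove z [] = []
  remove z (x ∷ xs) with x ≟ z
  ... | yes _ = remove z xs
  ... | no _  = x ∷ remove z xs

  remove-All : ∀ {P : Carrier → Set} z {xs} → All P xs → All P (remove z xs)
  remove-All z {[]}     []         = []
  remove-All z {x ∷ xs} (px ∷ pxs) with x ≟ z
  ... | yes _ = remove-All z pxs
  ... | no _  = px ∷ remove-All z pxs

  remove-≢ : ∀ z xs → All (_≢ z) (remove z xs)
  remove-≢ z [] = []
  remove-≢ z (x ∷ xs) with x ≟ z
  ... | yes _   = remove-≢ z xs
  ... | no x≢z  = x≢z ∷ remove-≢ z xs

  remove-unique : ∀ z {xs} → Unique xs → Unique (remove z xs)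
  remove-unique z {[]}     []           = []
  remove-unique z {x ∷ xs} (x∉xs ∷ uxs) with x ≟ z
  ... | yes _ = remove-unique z uxs
  ... | no _  = remove-All z x∉xs ∷ remove-unique z uxs

  length-remove : ∀ z {xs} → Unique xs → length xs ≤ suc (length (remove z xs))
  length-remove z {[]}     []           = z≤n
  length-remove z {x ∷ xs} (x∉xs ∷ uxs) with x ≟ z
  ... | yes refl = s≤s (ℕ.≤-reflexive (sym (remove-absent xs x∉xs)))
    where
    remove-absent : ∀ ys → All (x ≢_) ys → length (remove x ys) ≡ length ys
    remove-absent []       []           = refl
    remove-absent (y ∷ ys) (x≢y ∷ x∉ys) with y ≟ x
    ... | yes y≡x = ⊥-elim (x≢y (sym y≡x))
    ... | no _    = cong suc (remove-absent ys x∉ys)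
  ... | no _     = s≤s (length-remove z uxs)

  elementsExcept : List Carrier → List Carrier
  elementsExcept = foldr remove elements

  elementsExcept-unique : ∀ E → Unique (elementsExcept E)
  elementsExcept-unique []      = elements-unique
  elementsExcept-unique (z ∷ E) = remove-unique z (elementsExcept-unique E)

  length-elementsExcept : ∀ E → q ≤ length E ℕ.+ length (elementsExcept E)
  length-elementsExcept []      = ℕ.≤-reflexive (sym length-elements)
  length-elementsExcept (z ∷ E) = ℕ.≤-trans (length-elementsExcept E)
    (ℕ.≤-trans (ℕ.+-monoʳ-≤ (length E) (length-remove z (elementsExcept-unique E)))
               (ℕ.≤-reflexive (ℕ.+-suc (length E) _)))

  elementsExcept-∉ : ∀ E → All (_∉ E) (elementsExcept E)
  elementsExcept-∉ []      = All.universal (λ _ ()) elements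
  elementsExcept-∉ (z ∷ E) =
    All.zipWith ∉-∷ (remove-≢ z (elementsExcept E) , remove-All z (elementsExcept-∉ E))
    where
    ∉-∷ : ∀ {x} → x ≢ z × x ∉ E → x ∉ z ∷ E
    ∉-∷ (x≢z , x∉E) (here x≡z)  = x≢z x≡z
    ∉-∷ (x≢z , x∉E) (there x∈E) = x∉E x∈E

module Univariate {q : ℕ} (F : FiniteField q) where

  open Field F
  open ≡-Reasoning

  eval : List Carrier → Carrier → Carrier
  eval []       t = 0#
  eval (c ∷ cs) t = c + t * eval cs t

  coeff : List Carrier → ℕ → Carrier
  coeff []       k       = 0#
  coeff (c ∷ cs) zero    = c
  coeff (c ∷ cs) (suc k) = coeff cs k

  coeff-≥length : ∀ cs {k} → length cs ≤ k → coeff cs k ≡ 0#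
  coeff-≥length []                   _         = refl
  coeff-≥length (c ∷ cs) {suc k} (s≤s len≤k) = coeff-≥length cs len≤k

  infixl 6 _+ₚ_
  _+ₚ_ : List Carrier → List Carrier → List Carrier
  []       +ₚ ys       = ys
  (x ∷ xs) +ₚ []       = x ∷ xs
  (x ∷ xs) +ₚ (y ∷ ys) = (x + y) ∷ (xs +ₚ ys)

  eval-+ₚ : ∀ xs ys t → eval (xs +ₚ ys) t ≡ eval xs t + eval ys t
  eval-+ₚ []       ys       t = sym (+-identityˡ _)
  eval-+ₚ (x ∷ xs) []       t = sym (+-identityʳ _)
  eval-+ₚ (x ∷ xs) (y ∷ ys) t = begin
    (x + y) + t * eval (xs +ₚ ys) t
      ≡⟨ cong (λ z → (x + y) + t * z) (eval-+ₚ xs ys t) ⟩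
    (x + y) + t * (eval xs t + eval ys t)
      ≡⟨ solve 5 (λ x y t a b → (x :+ y) :+ t :* (a :+ b) := (x :+ t :* a) :+ (y :+ t :* b))
        refl x y t (eval xs t) (eval ys t) ⟩
    (x + t * eval xs t) + (y + t * eval ys t) ∎

  coeff-+ₚ : ∀ xs ys k → coeff (xs +ₚ ys) k ≡ coeff xs k + coeff ys k
  coeff-+ₚ []       ys       k       = sym (+-identityˡ _)
  coeff-+ₚ (x ∷ xs) []       k       = sym (+-identityʳ _)
  coeff-+ₚ (x ∷ xs) (y ∷ ys) zero    = refl
  coeff-+ₚ (x ∷ xs) (y ∷ ys) (suc k) = coeff-+ₚ xs ys k

  length-+ₚ : ∀ xs ys {k} → length xs ≤ k → length ys ≤ k → length (xs +ₚ ys) ≤ k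
  length-+ₚ []       ys       _          ys≤k       = ys≤k
  length-+ₚ (x ∷ xs) []       xs≤k       _          = xs≤k
  length-+ₚ (x ∷ xs) (y ∷ ys) (s≤s xs≤k) (s≤s ys≤k) = s≤s (length-+ₚ xs ys xs≤k ys≤k)

  infixr 7 _·ₚ_
  _·ₚ_ : Carrier → List Carrier → List Carrier
  c ·ₚ ys = List.map (c *_) ys

  eval-·ₚ : ∀ c ys t → eval (c ·ₚ ys) t ≡ c * eval ys t
  eval-·ₚ c []       t = sym (zeroʳ c)
  eval-·ₚ c (y ∷ ys) t = begin
    c * y + t * eval (c ·ₚ ys) t
      ≡⟨ cong (λ z → c * y + t * z) (eval-·ₚ c ys t) ⟩
    c * y + t * (c * eval ys t)
      ≡⟨ solve 4 (λ c y t a → c :* y :+ t :* (c :* a) := c :* (y :+ t :* a)) refl c y t (eval ys t) ⟩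
    c * (y + t * eval ys t)        ∎

  coeff-·ₚ : ∀ c ys k → coeff (c ·ₚ ys) k ≡ c * coeff ys k
  coeff-·ₚ c []       k       = sym (zeroʳ c)
  coeff-·ₚ c (y ∷ ys) zero    = refl
  coeff-·ₚ c (y ∷ ys) (suc k) = coeff-·ₚ c ys k

  infixl 7 _*ₚ_
  _*ₚ_ : List Carrier → List Carrier → List Carrier
  []       *ₚ ys = []
  (x ∷ xs) *ₚ ys = x ·ₚ ys +ₚ (0# ∷ xs *ₚ ys)

  eval-*ₚ : ∀ xs ys t → eval (xs *ₚ ys) t ≡ eval xs t * eval ys t
  eval-*ₚ []       ys t = sym (zeroˡ _)
  eval-*ₚ (x ∷ xs) ys t = begin
    eval (x ·ₚ ys +ₚ (0# ∷ xs *ₚ ys)) t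
      ≡⟨ eval-+ₚ (x ·ₚ ys) _ t ⟩
    eval (x ·ₚ ys) t + (0# + t * eval (xs *ₚ ys) t)
      ≡⟨ cong₂ (λ a b → a + (0# + t * b)) (eval-·ₚ x ys t) (eval-*ₚ xs ys t) ⟩
    x * eval ys t + (0# + t * (eval xs t * eval ys t))
      ≡⟨ solve 4 (λ x t a b → x :* b :+ (con 0ℤ :+ t :* (a :* b)) := (x :+ t :* a) :* b)
        refl x t (eval xs t) (eval ys t) ⟩
    (x + t * eval xs t) * eval ys t                    ∎

  private
    length-·ₚ-≤ : ∀ c ys D E → length ys ≤ suc E → length (c ·ₚ ys) ≤ suc (D ℕ.+ E)
    length-·ₚ-≤ c ys D E ys≤E =
      subst (_≤ _) (sym (List.length-map (c *_) ys)) (ℕ.≤-trans ys≤E (s≤s (ℕ.m≤n+m E D)))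

  length-*ₚ : ∀ xs ys D E → length xs ≤ suc D → length ys ≤ suc E → length (xs *ₚ ys) ≤ suc (D ℕ.+ E)
  length-*ₚ []            ys D       E _          _    = z≤n
  length-*ₚ (x ∷ [])      ys D       E _          ys≤E =
    length-+ₚ (x ·ₚ ys) (0# ∷ []) (length-·ₚ-≤ x ys D E ys≤E) (s≤s z≤n)
  length-*ₚ (x ∷ x′ ∷ xs) ys (suc D) E (s≤s xs≤D) ys≤E =
    length-+ₚ (x ·ₚ ys) (0# ∷ (x′ ∷ xs) *ₚ ys) (length-·ₚ-≤ x ys (suc D) E ys≤E)
      (s≤s (length-*ₚ (x′ ∷ xs) ys D E xs≤D ys≤E))

  private
    coeff-[0] : ∀ k → coeff (0# ∷ []) k ≡ 0#
    coeff-[0] zero    = refl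
    coeff-[0] (suc k) = refl

  coeff-*ₚ : ∀ xs ys D E → length xs ≤ suc D → length ys ≤ suc E →
             coeff (xs *ₚ ys) (D ℕ.+ E) ≡ coeff xs D * coeff ys E
  coeff-*ₚ []            ys D       E _          _    = sym (zeroˡ _)
  coeff-*ₚ (x ∷ [])      ys zero    E _          _    = begin
    coeff (x ·ₚ ys +ₚ (0# ∷ [])) E       ≡⟨ coeff-+ₚ (x ·ₚ ys) _ E ⟩
    coeff (x ·ₚ ys) E + coeff (0# ∷ []) E ≡⟨ cong₂ _+_ (coeff-·ₚ x ys E) (coeff-[0] E) ⟩
    x * coeff ys E + 0#                  ≡⟨ +-identityʳ _ ⟩
    x * coeff ys E                       ∎
  coeff-*ₚ (x ∷ [])      ys (suc D) E _          ys≤E = begin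
    coeff (x ·ₚ ys +ₚ (0# ∷ [])) (suc D ℕ.+ E)
      ≡⟨ coeff-+ₚ (x ·ₚ ys) _ (suc D ℕ.+ E) ⟩
    coeff (x ·ₚ ys) (suc D ℕ.+ E) + coeff [] (D ℕ.+ E)
      ≡⟨ cong (_+ 0#) (coeff-·ₚ x ys _) ⟩
    x * coeff ys (suc D ℕ.+ E) + 0#
      ≡⟨ cong (λ z → x * z + 0#) (coeff-≥length ys (ℕ.≤-trans ys≤E (s≤s (ℕ.m≤n+m E D)))) ⟩
    x * 0# + 0#
      ≡⟨ solve 2 (λ x c → x :* con 0ℤ :+ con 0ℤ := con 0ℤ :* c) refl x (coeff ys E) ⟩
    0# * coeff ys E                                  ∎
  coeff-*ₚ (x ∷ x′ ∷ xs) ys (suc D) E (s≤s xs≤D) ys≤E = begin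
    coeff (x ·ₚ ys +ₚ (0# ∷ (x′ ∷ xs) *ₚ ys)) (suc D ℕ.+ E)
      ≡⟨ coeff-+ₚ (x ·ₚ ys) _ (suc D ℕ.+ E) ⟩
    coeff (x ·ₚ ys) (suc D ℕ.+ E) + coeff ((x′ ∷ xs) *ₚ ys) (D ℕ.+ E)
      ≡⟨ cong₂ _+_ (coeff-·ₚ x ys _) (coeff-*ₚ (x′ ∷ xs) ys D E xs≤D ys≤E) ⟩
    x * coeff ys (suc D ℕ.+ E) + coeff (x′ ∷ xs) D * coeff ys E
      ≡⟨ cong (λ z → x * z + coeff (x′ ∷ xs) D * coeff ys E) (coeff-≥length ys (ℕ.≤-trans ys≤E (s≤s (ℕ.m≤n+m E D)))) ⟩
    x * 0# + coeff (x′ ∷ xs) D * coeff ys E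
      ≡⟨ solve 2 (λ x c → x :* con 0ℤ :+ c := c) refl x (coeff (x′ ∷ xs) D * coeff ys E) ⟩
    coeff (x′ ∷ xs) D * coeff ys E                                          ∎

  quotientBy : Carrier → List Carrier → List Carrier
  quotientBy r []           = []
  quotientBy r (c ∷ [])     = []
  quotientBy r (c ∷ d ∷ ds) = eval (d ∷ ds) r ∷ quotientBy r (d ∷ ds)

  eval-quotientBy : ∀ r cs t → eval cs t ≡ (t - r) * eval (quotientBy r cs) t + eval cs r
  eval-quotientBy r []           t = solve 2 (λ t r → con 0ℤ := (t :- r) :* con 0ℤ :+ con 0ℤ) refl t r
  eval-quotientBy r (c ∷ [])     t =
    solve 3 (λ c t r → c :+ t :* con 0ℤ := (t :- r) :* con 0ℤ :+ (c :+ r :* con 0ℤ)) refl c t r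
  eval-quotientBy r (c ∷ d ∷ ds) t = begin
    c + t * eval (d ∷ ds) t                  ≡⟨ cong (λ z → c + t * z) (eval-quotientBy r (d ∷ ds) t) ⟩
    c + t * ((t - r) * Q + e)                ≡⟨ solve 5 (λ c t r Q e → c :+ t :* ((t :- r) :* Q :+ e) :=
                                                  (t :- r) :* (e :+ t :* Q) :+ (c :+ r :* e)) refl c t r Q e ⟩
    (t - r) * (e + t * Q) + (c + r * e)      ∎
    where
    Q = eval (quotientBy r (d ∷ ds)) t
    e = eval (d ∷ ds) r

  length-quotientBy : ∀ r cs {m} → length cs ≤ suc m → length (quotientBy r cs) ≤ m
  length-quotientBy r []           _                 = z≤n
  length-quotientBy r (c ∷ [])     _                 = z≤n
  length-quotientBy r (c ∷ d ∷ ds) {suc m} (s≤s len≤m) = s≤s (length-quotientBy r (d ∷ ds) len≤m)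

  quotientBy-zero : ∀ r cs → All (_≡ 0#) (quotientBy r cs) → eval cs r ≡ 0# → All (_≡ 0#) cs
  quotientBy-zero r []           _          _        = []
  quotientBy-zero r (c ∷ [])     _          cs[r]≡0 =
    trans (sym (trans (cong (c +_) (zeroʳ r)) (+-identityʳ c))) cs[r]≡0 ∷ []
  quotientBy-zero r (c ∷ d ∷ ds) (e≡0 ∷ Q≡0) cs[r]≡0 = c≡0 ∷ quotientBy-zero r (d ∷ ds) Q≡0 e≡0
    where
    c≡0 : c ≡ 0#
    c≡0 = begin
      c                      ≡⟨ solve 2 (λ c r → c := c :+ r :* con 0ℤ) refl c r ⟩
      c + r * 0#             ≡⟨ cong (λ z → c + r * z) e≡0 ⟨
      c + r * eval (d ∷ ds) r ≡⟨ cs[r]≡0 ⟩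
      0#                     ∎

  quotientBy-root : ∀ {r x} cs → x ≢ r → eval cs r ≡ 0# → eval cs x ≡ 0# → eval (quotientBy r cs) x ≡ 0#
  quotientBy-root {r} {x} cs x≢r cs[r]≡0 cs[x]≡0
    with x*y≡0⇒x≡0⊎y≡0 (x - r) (eval (quotientBy r cs) x) (begin
      (x - r) * eval (quotientBy r cs) x        ≡⟨ +-identityʳ _ ⟨
      (x - r) * eval (quotientBy r cs) x + 0#   ≡⟨ cong ((x - r) * eval (quotientBy r cs) x +_) cs[r]≡0 ⟨
      (x - r) * eval (quotientBy r cs) x + eval cs r ≡⟨ eval-quotientBy r cs x ⟨
      eval cs x                                 ≡⟨ cs[x]≡0 ⟩
      0#                                        ∎)
  ... | inj₁ x-r≡0 = ⊥-elim (x≢r (x-y≡0⇒x≡y x r x-r≡0))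
  ... | inj₂ Q[x]≡0 = Q[x]≡0

  roots⇒zero : ∀ {rs} cs → Unique rs → length cs ≤ length rs → All (λ r → eval cs r ≡ 0#) rs → All (_≡ 0#) cs
  roots⇒zero {[]}     []  _             _   _                  = []
  roots⇒zero {r ∷ rs} cs  (r∉rs ∷ u-rs) len (cs[r]≡0 ∷ cs[rs]≡0) =
    quotientBy-zero r cs (roots⇒zero (quotientBy r cs) u-rs (length-quotientBy r cs len) Q[rs]≡0) cs[r]≡0
    where
    Q[rs]≡0 = All.zipWith (λ (r≢x , cs[x]≡0) → quotientBy-root cs (r≢x ∘ sym) cs[r]≡0 cs[x]≡0) (r∉rs , cs[rs]≡0)

  coeff-zeros : ∀ cs → All (_≡ 0#) cs → ∀ k → coeff cs k ≡ 0#
  coeff-zeros []       _          k       = refl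
  coeff-zeros (c ∷ cs) (c≡0 ∷ _)  zero    = c≡0
  coeff-zeros (c ∷ cs) (_ ∷ cs≡0) (suc k) = coeff-zeros cs cs≡0 k

  eval-zeros : ∀ cs → All (_≡ 0#) cs → ∀ t → eval cs t ≡ 0#
  eval-zeros []       _            t = refl
  eval-zeros (c ∷ cs) (c≡0 ∷ cs≡0) t = begin
    c + t * eval cs t  ≡⟨ cong₂ (λ a b → a + t * b) c≡0 (eval-zeros cs cs≡0 t) ⟩
    0# + t * 0#        ≡⟨ solve 1 (λ t → con 0ℤ :+ t :* con 0ℤ := con 0ℤ) refl t ⟩
    0#                 ∎

  PolyFn : ℕ → (Carrier → Carrier) → Carrier → Set
  PolyFn D f c = Σ (List Carrier) λ cs → length cs ≤ suc D × (∀ t → f t ≡ eval cs t) × coeff cs D ≡ c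

  PolyFn-const : ∀ c → PolyFn 0 (λ _ → c) c
  PolyFn-const c = c ∷ [] , s≤s z≤n , (λ t → solve 2 (λ c t → c := c :+ t :* con 0ℤ) refl c t) , refl

  PolyFn-quadratic : ∀ a b c → PolyFn 2 (λ t → a + t * b + t * t * c) c
  PolyFn-quadratic a b c = a ∷ b ∷ c ∷ [] , s≤s (s≤s (s≤s z≤n)) ,
    (λ t → solve 4 (λ a b c t → a :+ t :* b :+ t :* t :* c := a :+ t :* (b :+ t :* (c :+ t :* con 0ℤ))) refl a b c t) ,
    refl

  PolyFn-+ : ∀ {D f g a b} → PolyFn D f a → PolyFn D g b → PolyFn D (λ t → f t + g t) (a + b)
  PolyFn-+ (cs , cs≤D , f≡cs , cs[D]≡a) (ds , ds≤D , g≡ds , ds[D]≡b) =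
    cs +ₚ ds ,
    length-+ₚ cs ds cs≤D ds≤D ,
    (λ t → trans (cong₂ _+_ (f≡cs t) (g≡ds t)) (sym (eval-+ₚ cs ds t))) ,
    trans (coeff-+ₚ cs ds _) (cong₂ _+_ cs[D]≡a ds[D]≡b)

  PolyFn-* : ∀ {D E f g a b} → PolyFn D f a → PolyFn E g b → PolyFn (D ℕ.+ E) (λ t → f t * g t) (a * b)
  PolyFn-* {D} {E} (cs , cs≤D , f≡cs , cs[D]≡a) (ds , ds≤E , g≡ds , ds[E]≡b) =
    cs *ₚ ds ,
    length-*ₚ cs ds D E cs≤D ds≤E ,
    (λ t → trans (cong₂ _*_ (f≡cs t) (g≡ds t)) (sym (eval-*ₚ cs ds t))) ,
    trans (coeff-*ₚ cs ds D E cs≤D ds≤E) (cong₂ _*_ cs[D]≡a ds[E]≡b)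

  PolyFn-vanishing : ∀ {D f c} (E : List Carrier) → length E ℕ.+ D < q → PolyFn D f c →
                     (∀ t → t ∉ E → f t ≡ 0#) → c ≡ 0# × (∀ t → f t ≡ 0#)
  PolyFn-vanishing {D} E E+D<q (cs , cs≤D , f≡cs , cs[D]≡c) f≡0 =
    trans (sym cs[D]≡c) (coeff-zeros cs cs≡0 D) , (λ t → trans (f≡cs t) (eval-zeros cs cs≡0 t))
    where
    roots = elementsExcept E
    D<roots : suc D ≤ length roots
    D<roots = ℕ.+-cancelˡ-≤ (length E) (suc D) (length roots)
      (ℕ.≤-trans (ℕ.≤-reflexive (ℕ.+-suc (length E) D)) (ℕ.≤-trans E+D<q (length-elementsExcept E)))
    cs≡0 = roots⇒zero cs (elementsExcept-unique E) (ℕ.≤-trans cs≤D D<roots)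
      (All.map (λ {t} t∉E → trans (sym (f≡cs t)) (f≡0 t t∉E)) (elementsExcept-∉ E))

module Forms {q : ℕ} (F : FiniteField q) where

  open Field F
  open Univariate F
  open ≡-Reasoning

  -- Form n d: homogeneous polynomials of degree d in w, y₁, …, yₙ.  Evaluated at w = 1 such a form
  -- is an arbitrary polynomial of degree ≤ d in the y's; evaluated at w = 0 it is its top-degree part.
  data Form : ℕ → ℕ → Set where
    scalar : ∀ {d} → Carrier → Form zero d
    lift   : ∀ {n} → Form n zero → Form (suc n) zero
    extend : ∀ {n d} → Form n (suc d) → Form (suc n) d → Form (suc n) (suc d)

  ⟦_⟧ : ∀ {n d} → Form n d → Carrier → Vec Carrier n → Carrier
  ⟦ scalar {d} c ⟧ w []       = c * w ^ d
  ⟦ lift P       ⟧ w (y ∷ ys) = ⟦ P ⟧ w ys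
  ⟦ extend P₀ P  ⟧ w (y ∷ ys) = ⟦ P₀ ⟧ w ys + y * ⟦ P ⟧ w (y ∷ ys)

  ⟦⟧-homogeneous : ∀ {n d} (P : Form n d) a w ys → ⟦ P ⟧ (a * w) (Vec.map (a *_) ys) ≡ a ^ d * ⟦ P ⟧ w ys
  ⟦⟧-homogeneous (scalar {d} c) a w [] = trans (cong (c *_) ([x*y]^n≡x^n*y^n a w d))
    (solve 3 (λ c x y → c :* (x :* y) := x :* (c :* y)) refl c (a ^ d) (w ^ d))
  ⟦⟧-homogeneous (lift P) a w (y ∷ ys) = ⟦⟧-homogeneous P a w ys
  ⟦⟧-homogeneous (extend {d = d} P₀ P) a w (y ∷ ys) =
    trans (cong₂ (λ u v → u + (a * y) * v) (⟦⟧-homogeneous P₀ a w ys) (⟦⟧-homogeneous P a w (y ∷ ys)))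
      (solve 5 (λ a y aᵈ u v → a :* aᵈ :* u :+ (a :* y) :* (aᵈ :* v) := a :* aᵈ :* (u :+ y :* v))
         refl a y (a ^ d) (⟦ P₀ ⟧ w ys) (⟦ P ⟧ w (y ∷ ys)))

  ⟦⟧-origin : ∀ {n d} (P : Form n (suc d)) → ⟦ P ⟧ 0# (Vec.replicate n 0#) ≡ 0#
  ⟦⟧-origin {n} {d} P = begin
    ⟦ P ⟧ 0# 0ⁿ
      ≡⟨ cong₂ ⟦ P ⟧ (sym (zeroˡ 0#))
               (trans (cong (Vec.replicate n) (sym (zeroˡ 0#))) (sym (Vec.map-replicate (0# *_) 0# n))) ⟩
    ⟦ P ⟧ (0# * 0#) (Vec.map (0# *_) 0ⁿ)
      ≡⟨ ⟦⟧-homogeneous P 0# 0# 0ⁿ ⟩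
    0# ^ suc d * ⟦ P ⟧ 0# 0ⁿ
      ≡⟨ solve 2 (λ a b → con 0ℤ :* a :* b := con 0ℤ) refl (0# ^ d) (⟦ P ⟧ 0# 0ⁿ) ⟩
    0#                      ∎
    where
    0ⁿ = Vec.replicate n 0#

  constantOf : ∀ {n} → Form n zero → Carrier
  constantOf (scalar c) = c
  constantOf (lift P)   = constantOf P

  ⟦⟧-constant : ∀ {n} (P : Form n zero) w ys → ⟦ P ⟧ w ys ≡ constantOf P
  ⟦⟧-constant (scalar c) w []       = *-identityʳ c
  ⟦⟧-constant (lift P)   w (y ∷ ys) = ⟦⟧-constant P w ys

  lower : ∀ {n d} → Form n (suc d) → Form n d
  lower (scalar c)                = scalar c
  lower (extend {d = zero}  P₀ P) = lift (lower P₀)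
  lower (extend {d = suc d} P₀ P) = extend (lower P₀) (lower P)

  ⟦⟧-lower : ∀ {n d} (P : Form n (suc d)) ys → ⟦ P ⟧ 1# ys ≡ ⟦ lower P ⟧ 1# ys + ⟦ P ⟧ 0# ys
  ⟦⟧-lower (scalar {suc d} c) [] = begin
    c * (1# * 1# ^ d)
      ≡⟨ cong (λ z → c * (1# * z)) (1^n≡1 d) ⟩
    c * (1# * 1#)
      ≡⟨ solve 2 (λ c z → c :* (con 1ℤ :* con 1ℤ) := c :* con 1ℤ :+ c :* (con 0ℤ :* z)) refl c (0# ^ d) ⟩
    c * 1# + c * (0# * 0# ^ d)
      ≡⟨ cong (λ z → c * z + c * (0# * 0# ^ d)) (1^n≡1 d) ⟨
    c * 1# ^ d + c * (0# ^ suc d) ∎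
  ⟦⟧-lower (extend {d = zero} P₀ P) (y ∷ ys) = begin
    ⟦ P₀ ⟧ 1# ys + y * ⟦ P ⟧ 1# (y ∷ ys)
      ≡⟨ cong₂ (λ u v → u + y * v) (⟦⟧-lower P₀ ys)
               (trans (⟦⟧-constant P 1# (y ∷ ys)) (sym (⟦⟧-constant P 0# (y ∷ ys)))) ⟩
    (⟦ lower P₀ ⟧ 1# ys + ⟦ P₀ ⟧ 0# ys) + y * ⟦ P ⟧ 0# (y ∷ ys)
      ≡⟨ +-assoc _ _ _ ⟩
    ⟦ lower P₀ ⟧ 1# ys + (⟦ P₀ ⟧ 0# ys + y * ⟦ P ⟧ 0# (y ∷ ys)) ∎
  ⟦⟧-lower (extend {d = suc d} P₀ P) (y ∷ ys) = begin
    ⟦ P₀ ⟧ 1# ys + y * ⟦ P ⟧ 1# (y ∷ ys)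
      ≡⟨ cong₂ (λ u v → u + y * v) (⟦⟧-lower P₀ ys) (⟦⟧-lower P (y ∷ ys)) ⟩
    (a + b) + y * (c + e)
      ≡⟨ solve 5 (λ a b y c e → (a :+ b) :+ y :* (c :+ e) := (a :+ y :* c) :+ (b :+ y :* e))
        refl a b y c e ⟩
    (a + y * c) + (b + y * e)               ∎
    where
    a = ⟦ lower P₀ ⟧ 1# ys
    b = ⟦ P₀ ⟧ 0# ys
    c = ⟦ lower P ⟧ 1# (y ∷ ys)
    e = ⟦ P ⟧ 0# (y ∷ ys)

  VanishesOn : ∀ {n d} → List (Vec Carrier n) → Form n d → Set
  VanishesOn S P = ∀ s → s ∈ S → ⟦ P ⟧ 1# s ≡ 0#

  IsZero : ∀ {n d} → Form n d → Set
  IsZero (scalar c)    = c ≡ 0#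
  IsZero (lift P)      = IsZero P
  IsZero (extend P₀ P) = IsZero P₀ × IsZero P

  coeffsInFirst : ∀ {n d} → Form (suc n) d → Vec Carrier n → List Carrier
  coeffsInFirst (lift P)      ys = ⟦ P ⟧ 1# ys ∷ []
  coeffsInFirst (extend P₀ P) ys = ⟦ P₀ ⟧ 1# ys ∷ coeffsInFirst P ys

  eval-coeffsInFirst : ∀ {n d} (P : Form (suc n) d) y ys → ⟦ P ⟧ 1# (y ∷ ys) ≡ eval (coeffsInFirst P ys) y
  eval-coeffsInFirst (lift P)      y ys = sym (trans (cong (⟦ P ⟧ 1# ys +_) (zeroʳ y)) (+-identityʳ _))
  eval-coeffsInFirst (extend P₀ P) y ys = cong (λ z → ⟦ P₀ ⟧ 1# ys + y * z) (eval-coeffsInFirst P y ys)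

  length-coeffsInFirst : ∀ {n d} (P : Form (suc n) d) ys → length (coeffsInFirst P ys) ≡ suc d
  length-coeffsInFirst (lift P)      ys = refl
  length-coeffsInFirst (extend P₀ P) ys = cong suc (length-coeffsInFirst P ys)

  vanishing⇒isZero : ∀ {n d} → d < q → (P : Form n d) → (∀ ys → ⟦ P ⟧ 1# ys ≡ 0#) → IsZero P
  vanishing⇒isZero {d = d} _ (scalar c) P≡0 = trans (sym (trans (cong (c *_) (1^n≡1 d)) (*-identityʳ c))) (P≡0 [])
  vanishing⇒isZero {suc n} {d} d<q P P≡0 = coeffs-isZero d<q P coeffs≡0
    where
    coeffs≡0 : ∀ ys → All (_≡ 0#) (coeffsInFirst P ys)
    coeffs≡0 ys = roots⇒zero (coeffsInFirst P ys) elements-unique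
      (subst₂ _≤_ (sym (length-coeffsInFirst P ys)) (sym length-elements) d<q)
      (All.universal (λ y → trans (sym (eval-coeffsInFirst P y ys)) (P≡0 (y ∷ ys))) elements)
    coeffs-isZero : ∀ {d} → d < q → (P : Form (suc n) d) → (∀ ys → All (_≡ 0#) (coeffsInFirst P ys)) → IsZero P
    coeffs-isZero d<q (lift P)      P≡0 = vanishing⇒isZero d<q P (All.head ∘ P≡0)
    coeffs-isZero d<q (extend P₀ P) P≡0 =
      vanishing⇒isZero d<q P₀ (All.head ∘ P≡0) , coeffs-isZero (ℕ.<-trans (ℕ.n<1+n _) d<q) P (All.tail ∘ P≡0)

-- monomialCount n d = C(n + d, n), the number of coefficients of a Form n d.
monomialCount : ℕ → ℕ → ℕ
monomialCount zero    d       = 1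
monomialCount (suc n) zero    = monomialCount n zero
monomialCount (suc n) (suc d) = monomialCount n (suc d) ℕ.+ monomialCount (suc n) d

module MonomialCount where

  open import Data.Nat using (_+_; _*_; _^_; _!)
  open import Data.Nat.Solver using (module +-*-Solver)
  open +-*-Solver using (solve; _:=_; _:+_; _:*_; con)
  open ℕ.≤-Reasoning

  monomialCount-0 : ∀ n → monomialCount n 0 ≡ 1
  monomialCount-0 zero    = refl
  monomialCount-0 (suc n) = monomialCount-0 n

  monomialCount*n!*d!≡[n+d]! : ∀ n d → monomialCount n d * (n ! * d !) ≡ (n + d) !
  monomialCount*n!*d!≡[n+d]! zero    d    = trans (ℕ.+-identityʳ _) (ℕ.+-identityʳ _)
  monomialCount*n!*d!≡[n+d]! (suc n) zero = begin-equality
    monomialCount n 0 * (suc n ! * 1)  ≡⟨ cong (λ z → z * (suc n ! * 1)) (monomialCount-0 n) ⟩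
    1 * (suc n ! * 1)                  ≡⟨ solve 1 (λ x → con 1 :* (x :* con 1) := x) refl (suc n !) ⟩
    suc n !                            ≡⟨ cong _! (ℕ.+-identityʳ (suc n)) ⟨
    (suc n + 0) !                      ∎
  monomialCount*n!*d!≡[n+d]! (suc n) (suc d) = begin-equality
    (A + B) * ((suc n * n !) * (suc d * d !))
      ≡⟨ solve 6 (λ n d A B a b → (A :+ B) :* (((con 1 :+ n) :* a) :* ((con 1 :+ d) :* b)) :=
        (con 1 :+ n) :* (A :* (a :* ((con 1 :+ d) :* b))) :+ (con 1 :+ d) :* (B :* (((con 1 :+ n) :* a) :* b)))
        refl n d A B (n !) (d !) ⟩
    suc n * (A * (n ! * suc d !)) + suc d * (B * (suc n ! * d !))
      ≡⟨ cong₂ (λ u v → suc n * u + suc d * v)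
        (trans (monomialCount*n!*d!≡[n+d]! n (suc d)) (cong _! (ℕ.+-suc n d)))
        (monomialCount*n!*d!≡[n+d]! (suc n) d) ⟩
    suc n * X + suc d * X
      ≡⟨ ℕ.*-distribʳ-+ X (suc n) (suc d) ⟨
    (suc n + suc d) * X
      ≡⟨ cong (λ m → (suc n + suc d) * m !) (ℕ.+-suc n d) ⟨
    (suc n + suc d) !  ∎
    where
    A = monomialCount n (suc d)
    B = monomialCount (suc n) d
    X = (suc n + d) !

  [1+d]^n*d!≤[n+d]! : ∀ n d → suc d ^ n * d ! ≤ (n + d) !
  [1+d]^n*d!≤[n+d]! zero    d = ℕ.≤-reflexive (ℕ.+-identityʳ _)
  [1+d]^n*d!≤[n+d]! (suc n) d = begin
    (suc d * suc d ^ n) * d !  ≡⟨ ℕ.*-assoc (suc d) (suc d ^ n) (d !) ⟩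
    suc d * (suc d ^ n * d !)  ≤⟨ ℕ.*-mono-≤ (s≤s (ℕ.m≤n+m d n)) ([1+d]^n*d!≤[n+d]! n d) ⟩
    suc (n + d) * (n + d) !    ∎

  n!≤n^n : ∀ n → n ! ≤ n ^ n
  n!≤n^n zero    = ℕ.≤-refl
  n!≤n^n (suc n) = ℕ.*-monoʳ-≤ (suc n) (ℕ.≤-trans (n!≤n^n n) (ℕ.^-monoˡ-≤ n (ℕ.n≤1+n n)))

  [1+d]^n≤n^n*monomialCount : ∀ n d → suc d ^ n ≤ n ^ n * monomialCount n d
  [1+d]^n≤n^n*monomialCount n d = begin
    suc d ^ n
      ≤⟨ ℕ.*-cancelʳ-≤ (suc d ^ n) (monomialCount n d * n !) (d !) [1+d]^n*d!≤M*n!*d! ⟩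
    monomialCount n d * n !
      ≤⟨ ℕ.*-monoʳ-≤ (monomialCount n d) (n!≤n^n n) ⟩
    monomialCount n d * n ^ n
      ≡⟨ ℕ.*-comm (monomialCount n d) (n ^ n) ⟩
    n ^ n * monomialCount n d ∎
    where
    instance _ = d ℕ.!≢0
    [1+d]^n*d!≤M*n!*d! : suc d ^ n * d ! ≤ monomialCount n d * n ! * d !
    [1+d]^n*d!≤M*n!*d! = ℕ.≤-trans ([1+d]^n*d!≤[n+d]! n d)
      (ℕ.≤-reflexive (trans (sym (monomialCount*n!*d!≡[n+d]! n d)) (sym (ℕ.*-assoc (monomialCount n d) _ _))))

  [a*b]^n≡a^n*b^n : ∀ a b n → (a * b) ^ n ≡ a ^ n * b ^ n
  [a*b]^n≡a^n*b^n a b zero    = refl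
  [a*b]^n≡a^n*b^n a b (suc n) = trans (cong ((a * b) *_) ([a*b]^n≡a^n*b^n a b n))
    (solve 4 (λ a b x y → (a :* b) :* (x :* y) := (a :* x) :* (b :* y)) refl a b (a ^ n) (b ^ n))

  monomialCount≤⇒[2+2d]^n≤[2n]^n* : ∀ n d L → monomialCount n d ≤ L → (2 * suc d) ^ n ≤ (2 * n) ^ n * L
  monomialCount≤⇒[2+2d]^n≤[2n]^n* n d L count≤L = begin
    (2 * suc d) ^ n                  ≡⟨ [a*b]^n≡a^n*b^n 2 (suc d) n ⟩
    2 ^ n * suc d ^ n                ≤⟨ ℕ.*-monoʳ-≤ (2 ^ n) ([1+d]^n≤n^n*monomialCount n d) ⟩
    2 ^ n * (n ^ n * monomialCount n d) ≤⟨ ℕ.*-monoʳ-≤ (2 ^ n) (ℕ.*-monoʳ-≤ (n ^ n) count≤L) ⟩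
    2 ^ n * (n ^ n * L)              ≡⟨ ℕ.*-assoc (2 ^ n) _ _ ⟨
    (2 ^ n * n ^ n) * L              ≡⟨ cong (_* L) ([a*b]^n≡a^n*b^n 2 n n) ⟨
    (2 * n) ^ n * L                  ∎

module Interpolation {q : ℕ} (F : FiniteField q) where

  open Field F
  open Forms F
  open ≡-Reasoning

  dot : ∀ {m} → Vec Carrier m → Vec Carrier m → Carrier
  dot []       []       = 0#
  dot (a ∷ as) (b ∷ bs) = a * b + dot as bs

  Nonzero : ∀ {m} → Vec Carrier m → Set
  Nonzero = Any.Any (_≢ 0#)

  zeros : ∀ {m} → Vec Carrier m
  zeros = Vec.replicate _ 0#

  dot-zeros : ∀ {m} (r : Vec Carrier m) → dot r zeros ≡ 0#
  dot-zeros []      = refl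
  dot-zeros (a ∷ r) = trans (cong₂ _+_ (zeroʳ a) (dot-zeros r)) (+-identityʳ 0#)

  dot-scale : ∀ {m} c (a v : Vec Carrier m) → dot (Vec.map (c *_) a) v ≡ c * dot a v
  dot-scale c []      []      = sym (zeroʳ c)
  dot-scale c (x ∷ a) (y ∷ v) = trans (cong ((c * x) * y +_) (dot-scale c a v))
    (solve 4 (λ c x y e → (c :* x) :* y :+ c :* e := c :* (x :* y :+ e)) refl c x y (dot a v))

  dot-++ : ∀ m {k} (a : Vec Carrier m) (b : Vec Carrier k) v →
           dot (a Vec.++ b) v ≡ dot a (Vec.take m v) + dot b (Vec.drop m v)
  dot-++ zero    []      b v       = sym (+-identityˡ _)
  dot-++ (suc m) (x ∷ a) b (y ∷ v) = trans (cong (x * y +_) (dot-++ m a b v)) (sym (+-assoc _ _ _))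

  nonzero-++ : ∀ m {k} (v : Vec Carrier (m ℕ.+ k)) → Nonzero v → Nonzero (Vec.take m v) ⊎ Nonzero (Vec.drop m v)
  nonzero-++ zero    v       v≢0         = inj₂ v≢0
  nonzero-++ (suc m) (x ∷ v) (here x≢0)  = inj₁ (here x≢0)
  nonzero-++ (suc m) (x ∷ v) (there v≢0) with nonzero-++ m v v≢0
  ... | inj₁ take≢0 = inj₁ (there take≢0)
  ... | inj₂ drop≢0 = inj₂ drop≢0

  subtractMultiple : ∀ {m} → Carrier → Vec Carrier m → Vec Carrier m → Vec Carrier m
  subtractMultiple c = Vec.zipWith (λ x y → x - c * y)

  dot-subtractMultiple : ∀ {m} c (xs ys w : Vec Carrier m) →
                         dot (subtractMultiple c xs ys) w ≡ dot xs w - c * dot ys w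
  dot-subtractMultiple c [] [] [] = solve 1 (λ c → con 0ℤ := con 0ℤ :- c :* con 0ℤ) refl c
  dot-subtractMultiple c (x ∷ xs) (y ∷ ys) (w ∷ ws) = begin
    (x - c * y) * w + dot (subtractMultiple c xs ys) ws
      ≡⟨ cong ((x - c * y) * w +_) (dot-subtractMultiple c xs ys ws) ⟩
    (x - c * y) * w + (dot xs ws - c * dot ys ws)
      ≡⟨ solve 6 (λ x c y w a b → (x :- c :* y) :* w :+ (a :- c :* b) :=
        (x :* w :+ a) :- c :* (y :* w :+ b)) refl x c y w (dot xs ws) (dot ys ws) ⟩
    (x * w + dot xs ws) - c * (y * w + dot ys ws)         ∎

  data PivotSearch {N} (rows : List (Vec Carrier (suc N))) : Set where
    no-pivot : All (λ r → Vec.head r ≡ 0#) rows → PivotSearch rows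
    pivot    : ∀ pre r post → rows ≡ pre ++ r ∷ post → Vec.head r ≢ 0# → PivotSearch rows

  findPivot : ∀ {N} (rows : List (Vec Carrier (suc N))) → PivotSearch rows
  findPivot []         = no-pivot []
  findPivot (r ∷ rows) with Vec.head r ≟ 0#
  ... | no  r₀≢0 = pivot [] r rows refl r₀≢0
  ... | yes r₀≡0 with findPivot rows
  ...   | no-pivot rows₀≡0          = no-pivot (r₀≡0 ∷ rows₀≡0)
  ...   | pivot pre p post refl p₀≢0 = pivot (r ∷ pre) p post refl p₀≢0

  nonzero-solution : ∀ {N} (rows : List (Vec Carrier N)) → length rows < N →
                     Σ (Vec Carrier N) λ v → Nonzero v × All (λ r → dot r v ≡ 0#) rows
  nonzero-solution {suc N} rows rows<N with findPivot rows
  ... | no-pivot rows₀≡0 = 1# ∷ zeros , here (0≢1 ∘ sym) , All.map (λ {r} → solves r) rows₀≡0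
    where
    solves : ∀ (r : Vec Carrier (suc N)) → Vec.head r ≡ 0# → dot r (1# ∷ zeros) ≡ 0#
    solves (x ∷ r) x≡0 = trans (cong₂ (λ a b → a * 1# + b) x≡0 (dot-zeros r))
      (solve 0 (con 0ℤ :* con 1ℤ :+ con 0ℤ := con 0ℤ) refl)
  ... | pivot pre (a ∷ p) post refl a≢0 =
    v₀ ∷ w , there w≢0 , All.++⁺ (All.++⁻ˡ pre solves-rest) (solves-pivot ∷ All.++⁻ʳ pre solves-rest)
    where
    a⁻¹ = proj₁ (inverse a a≢0)
    a*a⁻¹≡1 = proj₂ (inverse a a≢0)
    eliminate : Vec Carrier (suc N) → Vec Carrier N
    eliminate (b ∷ x) = subtractMultiple (b * a⁻¹) x p
    reduced = List.map eliminate (pre ++ post)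
    reduced<N : length reduced < N
    reduced<N = ℕ.≤-pred (subst (λ k → suc k ≤ suc N) length-rows rows<N)
      where
      length-rows : length (pre ++ (a ∷ p) ∷ post) ≡ suc (length reduced)
      length-rows = trans (List.length-++-sucʳ pre (a ∷ p) post) (cong suc (sym (List.length-map eliminate (pre ++ post))))
    w = proj₁ (nonzero-solution reduced reduced<N)
    w≢0 = proj₁ (proj₂ (nonzero-solution reduced reduced<N))
    solves-reduced = proj₂ (proj₂ (nonzero-solution reduced reduced<N))
    v₀ = - (a⁻¹ * dot p w)
    solves-pivot : dot (a ∷ p) (v₀ ∷ w) ≡ 0#
    solves-pivot = begin
      a * - (a⁻¹ * dot p w) + dot p w
        ≡⟨ solve 3 (λ a a⁻¹ e → a :* :- (a⁻¹ :* e) :+ e := e :- (a :* a⁻¹) :* e) refl a a⁻¹ (dot p w) ⟩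
      dot p w - (a * a⁻¹) * dot p w
        ≡⟨ cong (λ z → dot p w - z * dot p w) a*a⁻¹≡1 ⟩
      dot p w - 1# * dot p w
        ≡⟨ solve 1 (λ e → e :- con 1ℤ :* e := con 0ℤ) refl (dot p w) ⟩
      0#                                 ∎
    solves-eliminated : ∀ x → dot (eliminate x) w ≡ 0# → dot x (v₀ ∷ w) ≡ 0#
    solves-eliminated (b ∷ x) x′·w≡0 = begin
      b * - (a⁻¹ * dot p w) + dot x w
        ≡⟨ solve 4 (λ b a⁻¹ e f → b :* :- (a⁻¹ :* e) :+ f := f :- (b :* a⁻¹) :* e) refl b a⁻¹ (dot p w) (dot x w) ⟩
      dot x w - (b * a⁻¹) * dot p w
        ≡⟨ dot-subtractMultiple (b * a⁻¹) x p w ⟨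
      dot (subtractMultiple (b * a⁻¹) x p) w
        ≡⟨ x′·w≡0 ⟩
      0#                                 ∎
    solves-rest : All (λ r → dot r (v₀ ∷ w) ≡ 0#) (pre ++ post)
    solves-rest = All.map (λ {x} → solves-eliminated x) (All.map⁻ solves-reduced)

  fromCoeffs : ∀ n d → Vec Carrier (monomialCount n d) → Form n d
  fromCoeffs zero    d       (c ∷ []) = scalar c
  fromCoeffs (suc n) zero    v        = lift (fromCoeffs n zero v)
  fromCoeffs (suc n) (suc d) v        =
    extend (fromCoeffs n (suc d) (Vec.take (monomialCount n (suc d)) v))
           (fromCoeffs (suc n) d (Vec.drop (monomialCount n (suc d)) v))

  monomials : ∀ n d → Vec Carrier n → Vec Carrier (monomialCount n d)
  monomials zero    d       []       = 1# ∷ []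
  monomials (suc n) zero    (y ∷ ys) = monomials n zero ys
  monomials (suc n) (suc d) (y ∷ ys) = monomials n (suc d) ys Vec.++ Vec.map (y *_) (monomials (suc n) d (y ∷ ys))

  ⟦fromCoeffs⟧ : ∀ n d v ys → ⟦ fromCoeffs n d v ⟧ 1# ys ≡ dot (monomials n d ys) v
  ⟦fromCoeffs⟧ zero    d       (c ∷ []) [] = trans (cong (c *_) (1^n≡1 d))
    (solve 1 (λ c → c :* con 1ℤ := con 1ℤ :* c :+ con 0ℤ) refl c)
  ⟦fromCoeffs⟧ (suc n) zero    v (y ∷ ys) = ⟦fromCoeffs⟧ n zero v ys
  ⟦fromCoeffs⟧ (suc n) (suc d) v (y ∷ ys) = begin
    ⟦ fromCoeffs n (suc d) v₁ ⟧ 1# ys + y * ⟦ fromCoeffs (suc n) d v₂ ⟧ 1# (y ∷ ys)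
      ≡⟨ cong₂ (λ a b → a + y * b) (⟦fromCoeffs⟧ n (suc d) v₁ ys) (⟦fromCoeffs⟧ (suc n) d v₂ (y ∷ ys)) ⟩
    dot (monomials n (suc d) ys) v₁ + y * dot (monomials (suc n) d (y ∷ ys)) v₂
      ≡⟨ cong (dot (monomials n (suc d) ys) v₁ +_) (dot-scale y (monomials (suc n) d (y ∷ ys)) v₂) ⟨
    dot (monomials n (suc d) ys) v₁ + dot (Vec.map (y *_) (monomials (suc n) d (y ∷ ys))) v₂
      ≡⟨ dot-++ (monomialCount n (suc d)) (monomials n (suc d) ys)
                (Vec.map (y *_) (monomials (suc n) d (y ∷ ys))) v ⟨
    dot (monomials (suc n) (suc d) (y ∷ ys)) v ∎
    where
    v₁ = Vec.take (monomialCount n (suc d)) v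
    v₂ = Vec.drop (monomialCount n (suc d)) v

  fromCoeffs-nonzero : ∀ n d v → Nonzero v → ¬ IsZero (fromCoeffs n d v)
  fromCoeffs-nonzero zero    d       (c ∷ []) (here c≢0) c≡0 = c≢0 c≡0
  fromCoeffs-nonzero (suc n) zero    v        v≢0        = fromCoeffs-nonzero n zero v v≢0
  fromCoeffs-nonzero (suc n) (suc d) v        v≢0 (P₀≡0 , P≡0) with nonzero-++ (monomialCount n (suc d)) v v≢0
  ... | inj₁ v₁≢0 = fromCoeffs-nonzero n (suc d) _ v₁≢0 P₀≡0
  ... | inj₂ v₂≢0 = fromCoeffs-nonzero (suc n) d _ v₂≢0 P≡0

  interpolate : ∀ n d (S : List (Vec Carrier n)) → length S < monomialCount n d →
                Σ (Form n d) λ P → ¬ IsZero P × All (λ s → ⟦ P ⟧ 1# s ≡ 0#) S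
  interpolate n d S S<count =
    fromCoeffs n d v , fromCoeffs-nonzero n d v v≢0 ,
    All.map (λ {s} v⊥s → trans (⟦fromCoeffs⟧ n d v s) v⊥s) (All.map⁻ solves)
    where
    system = List.map (monomials n d) S
    solution = nonzero-solution system (subst (_< monomialCount n d) (sym (List.length-map _ S)) S<count)
    v = proj₁ solution
    v≢0 = proj₁ (proj₂ solution)
    solves = proj₂ (proj₂ solution)

module OddNumbers where

  open import Data.Nat using (_+_; _*_; _^_; _%_; _/_)
  open import Data.Nat.DivMod using (m≡m%n+[m/n]*n)
  open import Data.Nat.Primality using (Prime; prime⇒nonTrivial)
  open import Data.Nat.Solver using (module +-*-Solver)
  open +-*-Solver using (solve; _:=_; _:+_; _:*_; con)

  Odd : ℕ → Set
  Odd m = ∃ λ a → m ≡ suc (a * 2)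

  %2≡1⇒odd : ∀ m → m % 2 ≡ 1 → Odd m
  %2≡1⇒odd m m%2≡1 = m / 2 , trans (m≡m%n+[m/n]*n m 2) (cong (_+ m / 2 * 2) m%2≡1)

  odd-* : ∀ {m n} → Odd m → Odd n → Odd (m * n)
  odd-* (a , refl) (b , refl) = a + b + a * b * 2 ,
    solve 2 (λ a b → (con 1 :+ a :* con 2) :* (con 1 :+ b :* con 2) := con 1 :+ (a :+ b :+ a :* b :* con 2) :* con 2) refl a b

  odd-^ : ∀ {m} → Odd m → ∀ k → Odd (m ^ k)
  odd-^ odd-m zero    = 0 , refl
  odd-^ odd-m (suc k) = odd-* odd-m (odd-^ odd-m k)

  oddPrimePower⇒≡3+d*2 : ∀ {q} → OddPrimePower q → ∃ λ d → q ≡ 3 + d * 2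
  oddPrimePower⇒≡3+d*2 {q} (p , k , p-prime , p%2≡1 , refl) with odd-^ (%2≡1⇒odd p p%2≡1) (suc k)
  ... | suc d , q≡3+d*2 = d , q≡3+d*2
  ... | zero  , q≡1     = ⊥-elim (ℕ.<-irrefl (sym q≡1) 1<q)
    where
    1<q : 1 < q
    1<q = ℕ.^-monoʳ-< p (ℕ.nonTrivial⇒n>1 p {{prime⇒nonTrivial p-prime}}) {0} {suc k} (s≤s z≤n)

module Conics {q : ℕ} (F : FiniteField q) where

  open Field F
  open Univariate F
  open Forms F
  open Geometry F
  open ≡-Reasoning

  conic : ∀ {n} → Pt n → Pt n → Pt n → Carrier → Pt n
  conic A B C t = (A ⊕ (t · B)) ⊕ ((t * t) · C)

  PolyFn-quadratic^ : ∀ a b c d → PolyFn (d ℕ.* 2) (λ t → (a + t * b + t * t * c) ^ d) (c ^ d)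
  PolyFn-quadratic^ a b c zero    = PolyFn-const 1#
  PolyFn-quadratic^ a b c (suc d) = PolyFn-* (PolyFn-quadratic a b c) (PolyFn-quadratic^ a b c d)

  PolyFn-restriction : ∀ {n d} (P : Form n d) w₀ w₁ w₂ (A B C : Pt n) →
    PolyFn (d ℕ.* 2) (λ t → ⟦ P ⟧ (w₀ + t * w₁ + t * t * w₂) (conic A B C t)) (⟦ P ⟧ w₂ C)
  PolyFn-restriction (scalar {d} c)  w₀ w₁ w₂ [] [] [] =
    PolyFn-* (PolyFn-const c) (PolyFn-quadratic^ w₀ w₁ w₂ d)
  PolyFn-restriction (lift P)       w₀ w₁ w₂ (a ∷ A) (b ∷ B) (c ∷ C) = PolyFn-restriction P w₀ w₁ w₂ A B C
  PolyFn-restriction (extend P₀ P)  w₀ w₁ w₂ (a ∷ A) (b ∷ B) (c ∷ C) =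
    PolyFn-+ (PolyFn-restriction P₀ w₀ w₁ w₂ A B C)
             (PolyFn-* (PolyFn-quadratic a b c) (PolyFn-restriction P w₀ w₁ w₂ (a ∷ A) (b ∷ B) (c ∷ C)))

  hyperbola-scaled : ∀ {n} (a b c : Pt n) t s → t * s ≡ 1# → t · ((a ⊕ (t · b)) ⊕ (s · c)) ≡ conic c a b t
  hyperbola-scaled []      []      []      t s ts≡1 = refl
  hyperbola-scaled (a ∷ A) (b ∷ B) (c ∷ C) t s ts≡1 = cong₂ _∷_ (begin
    t * (a + t * b + s * c)
      ≡⟨ solve 5 (λ a b c t s → t :* (a :+ t :* b :+ s :* c) := t :* s :* c :+ t :* a :+ t :* t :* b) refl a b c t s ⟩
    t * s * c + t * a + t * t * b
      ≡⟨ cong (λ z → z * c + t * a + t * t * b) ts≡1 ⟩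
    1# * c + t * a + t * t * b
      ≡⟨ cong (λ z → z + t * a + t * t * b) (*-identityˡ c) ⟩
    c + t * a + t * t * b            ∎)
    (hyperbola-scaled A B C t s ts≡1)

  onHyperbola-swap : ∀ {n} (a b c p : Pt n) → OnHyperbola a c b p → OnHyperbola a b c p
  onHyperbola-swap a b c p (t , s , ts≡1 , p≡) = s , t , trans (*-comm s t) ts≡1 , trans p≡ (swap a c b t s)
    where
    swap : ∀ {n} (a c b : Pt n) t s → (a ⊕ (t · c)) ⊕ (s · b) ≡ (a ⊕ (s · b)) ⊕ (t · c)
    swap []      []      []      t s = refl
    swap (a ∷ A) (c ∷ C) (b ∷ B) t s = cong₂ _∷_
      (solve 5 (λ a c b t s → a :+ t :* c :+ s :* b := a :+ s :* b :+ t :* c) refl a c b t s) (swap A C B t s)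

  plane-injective : ∀ {n} (a b c : Pt n) → LinIndep b c → ∀ {u v u′ v′} →
                    (a ⊕ (u · b)) ⊕ (v · c) ≡ (a ⊕ (u′ · b)) ⊕ (v′ · c) → u ≡ u′ × v ≡ v′
  plane-injective a b c b,c-independent {u} {v} {u′} {v′} same-point
    with b,c-independent (u - u′) (v - v′) (difference a b c same-point)
    where
    difference : ∀ {n} (a b c : Pt n) → (a ⊕ (u · b)) ⊕ (v · c) ≡ (a ⊕ (u′ · b)) ⊕ (v′ · c) →
                 ((u - u′) · b) ⊕ ((v - v′) · c) ≡ 𝟎
    difference []      []      []      _  = refl
    difference (a ∷ A) (b ∷ B) (c ∷ C) eq = cong₂ _∷_ (begin
      (u - u′) * b + (v - v′) * c
        ≡⟨ solve 7 (λ a b c u v u′ v′ → (u :- u′) :* b :+ (v :- v′) :* c :=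
          (a :+ u :* b :+ v :* c) :- (a :+ u′ :* b :+ v′ :* c)) refl a b c u v u′ v′ ⟩
      (a + u * b + v * c) - (a + u′ * b + v′ * c)
        ≡⟨ cong (_- (a + u′ * b + v′ * c)) (Vec.∷-injectiveˡ eq) ⟩
      (a + u′ * b + v′ * c) - (a + u′ * b + v′ * c)
        ≡⟨ -‿inverseʳ _ ⟩
      0#                                               ∎)
      (difference A B C (Vec.∷-injectiveʳ eq))
  ... | u-u′≡0 , v-v′≡0 = x-y≡0⇒x≡y u u′ u-u′≡0 , x-y≡0⇒x≡y v v′ v-v′≡0

  combine : ∀ {n} → Carrier → Carrier → Carrier → Pt n → Pt n → Pt n → Pt n
  combine α β γ a b c = ((α · a) ⊕ (β · b)) ⊕ (γ · c)

  conic-combine : ∀ {n} α₀ α₁ α₂ β₀ β₁ β₂ γ₀ γ₁ γ₂ (a b c : Pt n) m →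
    conic (combine α₀ β₀ γ₀ a b c) (combine α₁ β₁ γ₁ a b c) (combine α₂ β₂ γ₂ a b c) m ≡
    combine (α₀ + m * α₁ + m * m * α₂) (β₀ + m * β₁ + m * m * β₂) (γ₀ + m * γ₁ + m * m * γ₂) a b c
  conic-combine α₀ α₁ α₂ β₀ β₁ β₂ γ₀ γ₁ γ₂ []      []      []      m = refl
  conic-combine α₀ α₁ α₂ β₀ β₁ β₂ γ₀ γ₁ γ₂ (a ∷ A) (b ∷ B) (c ∷ C) m = cong₂ _∷_
    (solve 13 (λ α₀ α₁ α₂ β₀ β₁ β₂ γ₀ γ₁ γ₂ a b c m →
         (α₀ :* a :+ β₀ :* b :+ γ₀ :* c)
       :+ m :* (α₁ :* a :+ β₁ :* b :+ γ₁ :* c)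
       :+ m :* m :* (α₂ :* a :+ β₂ :* b :+ γ₂ :* c)
       :=    (α₀ :+ m :* α₁ :+ m :* m :* α₂) :* a
          :+ (β₀ :+ m :* β₁ :+ m :* m :* β₂) :* b
          :+ (γ₀ :+ m :* γ₁ :+ m :* m :* γ₂) :* c)
       refl α₀ α₁ α₂ β₀ β₁ β₂ γ₀ γ₁ γ₂ a b c m)
    (conic-combine α₀ α₁ α₂ β₀ β₁ β₂ γ₀ γ₁ γ₂ A B C m)

  plane≡combine : ∀ {n} t u v (a b c : Pt n) → t · ((a ⊕ (u · b)) ⊕ (v · c)) ≡ combine (t * 1#) (t * u) (t * v) a b c
  plane≡combine t u v []      []      []      = refl
  plane≡combine t u v (a ∷ A) (b ∷ B) (c ∷ C) = cong₂ _∷_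
    (solve 6 (λ t u v a b c → t :* (a :+ u :* b :+ v :* c) := t :* con 1ℤ :* a :+ t :* u :* b :+ t :* v :* c) refl t u v a b c)
    (plane≡combine t u v A B C)

  combine-1 : ∀ {n} u v (a b c : Pt n) → combine 1# u v a b c ≡ (a ⊕ (u · b)) ⊕ (v · c)
  combine-1 u v []      []      []      = refl
  combine-1 u v (a ∷ A) (b ∷ B) (c ∷ C) = cong₂ _∷_ (cong (λ z → z + u * b + v * c) (*-identityˡ a)) (combine-1 u v A B C)

  ⟦⟧-along-hyperbola : ∀ {n d} (P : Form n d) (a b c : Pt n) t s → t * s ≡ 1# →
    ⟦ P ⟧ (0# + t * 1# + t * t * 0#) (conic c a b t) ≡ t ^ d * ⟦ P ⟧ 1# ((a ⊕ (t · b)) ⊕ (s · c))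
  ⟦⟧-along-hyperbola P a b c t s ts≡1 =
    trans (cong₂ ⟦ P ⟧ (solve 1 (λ t → con 0ℤ :+ t :* con 1ℤ :+ t :* t :* con 0ℤ := t :* con 1ℤ) refl t)
                       (sym (hyperbola-scaled a b c t s ts≡1)))
          (⟦⟧-homogeneous P t 1# _)

  ⟦⟧-along-parabola : ∀ {n d} (P : Form n d) (a b c : Pt n) t →
    ⟦ P ⟧ (1# + t * 0# + t * t * 0#) (conic a b c t) ≡ ⟦ P ⟧ 1# (conic a b c t)
  ⟦⟧-along-parabola P a b c t =
    cong (λ w → ⟦ P ⟧ w (conic a b c t)) (solve 1 (λ t → con 1ℤ :+ t :* con 0ℤ :+ t :* t :* con 0ℤ := con 1ℤ) refl t)

module Kakeya {q : ℕ} (F : FiniteField q) {n : ℕ} (S : List (Vec (FiniteField.Carrier F) n)) where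

  open Field F
  open Univariate F
  open Forms F
  open Geometry F
  open Conics F
  open ≡-Reasoning

  top-vanishes-on-hyperbola-direction : ∀ {d} (P : Form n d) → 1 ℕ.+ d ℕ.* 2 < q → VanishesOn S P →
    ∀ a b c → ContainedIn (OnHyperbola a b c) S → ⟦ P ⟧ 0# b ≡ 0#
  top-vanishes-on-hyperbola-direction {d} P bound P|S≡0 a b c H⊆S =
    proj₁ (PolyFn-vanishing (0# ∷ []) bound (PolyFn-restriction P 0# 1# 0# c a b) vanishes)
    where
    vanishes : ∀ t → t ∉ 0# ∷ [] → ⟦ P ⟧ (0# + t * 1# + t * t * 0#) (conic c a b t) ≡ 0#
    vanishes t t∉[0] = begin
      ⟦ P ⟧ (0# + t * 1# + t * t * 0#) (conic c a b t)
        ≡⟨ ⟦⟧-along-hyperbola P a b c t t⁻¹ t*t⁻¹≡1 ⟩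
      t ^ d * ⟦ P ⟧ 1# point
        ≡⟨ cong (t ^ d *_) (P|S≡0 point (H⊆S point (t , t⁻¹ , t*t⁻¹≡1 , refl))) ⟩
      t ^ d * 0#
        ≡⟨ zeroʳ _ ⟩
      0#                                              ∎
      where
      t⁻¹ = proj₁ (inverse t (t∉[0] ∘ here))
      t*t⁻¹≡1 = proj₂ (inverse t (t∉[0] ∘ here))
      point = (a ⊕ (t · b)) ⊕ (t⁻¹ · c)

  top-vanishes-on-parabola-direction : ∀ {d} (P : Form n d) → d ℕ.* 2 < q → VanishesOn S P →
    ∀ a b c → ContainedIn (OnParabola a b c) S → ⟦ P ⟧ 0# c ≡ 0#
  top-vanishes-on-parabola-direction P bound P|S≡0 a b c P⊆S =
    proj₁ (PolyFn-vanishing [] bound (PolyFn-restriction P 1# 0# 0# a b c) vanishes)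
    where
    vanishes : ∀ t → t ∉ [] → ⟦ P ⟧ (1# + t * 0# + t * t * 0#) (conic a b c t) ≡ 0#
    vanishes t _ = trans (⟦⟧-along-parabola P a b c t) (P|S≡0 _ (P⊆S _ (t , refl)))

  top-vanishes : ConicalKakeya S → ∀ {d} (P : Form n (suc d)) → 1 ℕ.+ suc d ℕ.* 2 < q → VanishesOn S P →
                 ∀ y → ⟦ P ⟧ 0# y ≡ 0#
  top-vanishes kakeya P bound P|S≡0 y with Vec.≡-dec _≟_ y 𝟎
  ... | yes refl = ⟦⟧-origin P
  ... | no y≢0 with kakeya y y≢0
  ...   | a , b , c , _ , inj₁ (inj₁ refl , H⊆S) =
    top-vanishes-on-hyperbola-direction P bound P|S≡0 a y c H⊆S
  ...   | a , b , c , _ , inj₁ (inj₂ refl , H⊆S) =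
    top-vanishes-on-hyperbola-direction P bound P|S≡0 a y b (λ p → H⊆S p ∘ onHyperbola-swap a b y p)
  ...   | a , b , c , _ , inj₂ (refl , P⊆S)      =
    top-vanishes-on-parabola-direction P (ℕ.<⇒≤ bound) P|S≡0 a b y P⊆S

  vanishes-everywhere : ConicalKakeya S → ∀ {s₀} → s₀ ∈ S → ∀ {d} → 1 ℕ.+ d ℕ.* 2 < q →
                        (P : Form n d) → VanishesOn S P → ∀ y → ⟦ P ⟧ 1# y ≡ 0#
  vanishes-everywhere kakeya {s₀} s₀∈S {zero} bound P P|S≡0 y =
    trans (⟦⟧-constant P 1# y) (trans (sym (⟦⟧-constant P 1# s₀)) (P|S≡0 s₀ s₀∈S))
  vanishes-everywhere kakeya s₀∈S {suc d} bound P P|S≡0 y = begin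
    ⟦ P ⟧ 1# y
      ≡⟨ ⟦⟧-lower P y ⟩
    ⟦ lower P ⟧ 1# y + ⟦ P ⟧ 0# y
      ≡⟨ cong₂ _+_ (vanishes-everywhere kakeya s₀∈S (ℕ.m+n≤o⇒n≤o 2 bound) (lower P) lower|S≡0 y)
        (top≡0 y) ⟩
    0# + 0#
      ≡⟨ +-identityʳ 0# ⟩
    0#                                ∎
    where
    top≡0 = top-vanishes kakeya P bound P|S≡0
    lower|S≡0 : VanishesOn S (lower P)
    lower|S≡0 s s∈S = begin
      ⟦ lower P ⟧ 1# s                ≡⟨ +-identityʳ _ ⟨
      ⟦ lower P ⟧ 1# s + 0#           ≡⟨ cong (⟦ lower P ⟧ 1# s +_) (top≡0 s) ⟨
      ⟦ lower P ⟧ 1# s + ⟦ P ⟧ 0# s   ≡⟨ ⟦⟧-lower P s ⟨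
      ⟦ P ⟧ 1# s                      ≡⟨ P|S≡0 s s∈S ⟩
      0#                              ∎

-- The chord of the ellipse v² = g u² + k through (u₀, v₀) with slope m meets it again at
-- (u₀ + W, - v₀ + m W), where W (m² - g) = 2 (g u₀ + v₀ m).
module EllipseChord {q : ℕ} (F : FiniteField q) where

  open Field F
  open ≡-Reasoning

  chord-parameter : ∀ {g} → (∀ y → y * y ≢ g) → ∀ u₀ v₀ m →
                    Σ Carrier λ W → W * (m * m - g) ≡ (1# + 1#) * (g * u₀ + v₀ * m)
  chord-parameter {g} g-nonSquare u₀ v₀ m = N * δ⁻¹ , (begin
    N * δ⁻¹ * δ    ≡⟨ *-assoc N δ⁻¹ δ ⟩
    N * (δ⁻¹ * δ)  ≡⟨ cong (N *_) (trans (*-comm δ⁻¹ δ) δ*δ⁻¹≡1) ⟩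
    N * 1#         ≡⟨ *-identityʳ N ⟩
    N              ∎)
    where
    N = (1# + 1#) * (g * u₀ + v₀ * m)
    δ = m * m - g
    δ≢0 : δ ≢ 0#
    δ≢0 δ≡0 = g-nonSquare m (x-y≡0⇒x≡y _ _ δ≡0)
    δ⁻¹ = proj₁ (inverse δ δ≢0)
    δ*δ⁻¹≡1 = proj₂ (inverse δ δ≢0)

  module _ {g u₀ v₀ m W : Carrier} (W-def : W * (m * m - g) ≡ (1# + 1#) * (g * u₀ + v₀ * m)) where

    chord-on-ellipse : ∀ {k} → v₀ * v₀ ≡ g * u₀ * u₀ + k →
                       (- v₀ + m * W) * (- v₀ + m * W) ≡ g * (u₀ + W) * (u₀ + W) + k
    chord-on-ellipse {k} on-ellipse = begin
      (- v₀ + m * W) * (- v₀ + m * W)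
        ≡⟨ solve 5 (λ v₀ u₀ m W g → (:- v₀ :+ m :* W) :* (:- v₀ :+ m :* W) :=
          g :* (u₀ :+ W) :* (u₀ :+ W) :+ (v₀ :* v₀ :- g :* u₀ :* u₀)
          :+ W :* (W :* (m :* m :- g) :- (con 1ℤ :+ con 1ℤ) :* (g :* u₀ :+ v₀ :* m))) refl v₀ u₀ m W g ⟩
      g * (u₀ + W) * (u₀ + W) + (v₀ * v₀ - g * u₀ * u₀) + W * (W * (m * m - g) - N)
        ≡⟨ cong₂ (λ a b → g * (u₀ + W) * (u₀ + W) + (a - g * u₀ * u₀) + W * (b - N)) on-ellipse W-def ⟩
      g * (u₀ + W) * (u₀ + W) + ((g * u₀ * u₀ + k) - g * u₀ * u₀) + W * (N - N)
        ≡⟨ solve 5 (λ a b k N W → a :+ ((b :+ k) :- b) :+ W :* (N :- N) := a :+ k)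
                 refl (g * (u₀ + W) * (u₀ + W)) (g * u₀ * u₀) k N W ⟩
      g * (u₀ + W) * (u₀ + W) + k ∎
      where
      N = (1# + 1#) * (g * u₀ + v₀ * m)

    chord-u-scaled : g * u₀ + m * ((1# + 1#) * v₀) + m * m * u₀ ≡ (m * m - g) * (u₀ + W)
    chord-u-scaled = begin
      g * u₀ + m * ((1# + 1#) * v₀) + m * m * u₀
        ≡⟨ solve 4 (λ g u₀ v₀ m → g :* u₀ :+ m :* ((con 1ℤ :+ con 1ℤ) :* v₀) :+ m :* m :* u₀ :=
          (m :* m :- g) :* u₀ :+ (con 1ℤ :+ con 1ℤ) :* (g :* u₀ :+ v₀ :* m)) refl g u₀ v₀ m ⟩
      (m * m - g) * u₀ + (1# + 1#) * (g * u₀ + v₀ * m)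
        ≡⟨ cong ((m * m - g) * u₀ +_) W-def ⟨
      (m * m - g) * u₀ + W * (m * m - g)
        ≡⟨ solve 3 (λ δ u₀ W → δ :* u₀ :+ W :* δ := δ :* (u₀ :+ W)) refl (m * m - g) u₀ W ⟩
      (m * m - g) * (u₀ + W)                        ∎

    chord-v-scaled : g * v₀ + m * ((1# + 1#) * g * u₀) + m * m * v₀ ≡ (m * m - g) * (- v₀ + m * W)
    chord-v-scaled = begin
      g * v₀ + m * ((1# + 1#) * g * u₀) + m * m * v₀
        ≡⟨ solve 4 (λ g u₀ v₀ m → g :* v₀ :+ m :* ((con 1ℤ :+ con 1ℤ) :* g :* u₀) :+ m :* m :* v₀ :=
          :- ((m :* m :- g) :* v₀) :+ m :* ((con 1ℤ :+ con 1ℤ) :* (g :* u₀ :+ v₀ :* m))) refl g u₀ v₀ m ⟩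
      - ((m * m - g) * v₀) + m * ((1# + 1#) * (g * u₀ + v₀ * m))
        ≡⟨ cong (λ z → - ((m * m - g) * v₀) + m * z) W-def ⟨
      - ((m * m - g) * v₀) + m * (W * (m * m - g))
        ≡⟨ solve 4 (λ δ v₀ m W → :- (δ :* v₀) :+ m :* (W :* δ) := δ :* (:- v₀ :+ m :* W)) refl (m * m - g) v₀ m W ⟩
      (m * m - g) * (- v₀ + m * W)                     ∎

    second-point≡first⇒v₀≡0 : 1# + 1# ≢ 0# → W ≡ 0# → - v₀ + m * W ≡ v₀ → v₀ ≡ 0#
    second-point≡first⇒v₀≡0 2≢0 W≡0 v≡v₀ with x*y≡0⇒x≡0⊎y≡0 (1# + 1#) v₀ (begin
      (1# + 1#) * v₀
        ≡⟨ solve 3 (λ v₀ m W → (con 1ℤ :+ con 1ℤ) :* v₀ := v₀ :- (:- v₀ :+ m :* W) :+ m :* W) refl v₀ m W ⟩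
      v₀ - (- v₀ + m * W) + m * W
        ≡⟨ cong₂ (λ a b → v₀ - a + m * b) v≡v₀ W≡0 ⟩
      v₀ - v₀ + m * 0#
        ≡⟨ solve 2 (λ v₀ m → v₀ :- v₀ :+ m :* con 0ℤ := con 0ℤ) refl v₀ m ⟩
      0#                          ∎)
    ... | inj₁ 2≡0  = ⊥-elim (2≢0 2≡0)
    ... | inj₂ v₀≡0 = v₀≡0

    second-point≡first⇒u₀≡0 : 1# + 1# ≢ 0# → g ≢ 0# → W ≡ 0# → v₀ ≡ 0# → u₀ ≡ 0#
    second-point≡first⇒u₀≡0 2≢0 g≢0 W≡0 v₀≡0 with x*y≡0⇒x≡0⊎y≡0 ((1# + 1#) * g) u₀ (begin
      (1# + 1#) * g * u₀
        ≡⟨ solve 4 (λ g u₀ v₀ m → (con 1ℤ :+ con 1ℤ) :* g :* u₀ :=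
          (con 1ℤ :+ con 1ℤ) :* (g :* u₀ :+ v₀ :* m) :- (con 1ℤ :+ con 1ℤ) :* v₀ :* m) refl g u₀ v₀ m ⟩
      (1# + 1#) * (g * u₀ + v₀ * m) - (1# + 1#) * v₀ * m
        ≡⟨ cong₂ (λ a b → a - (1# + 1#) * b * m) (sym W-def) v₀≡0 ⟩
      W * (m * m - g) - (1# + 1#) * 0# * m
        ≡⟨ cong (λ z → z * (m * m - g) - (1# + 1#) * 0# * m) W≡0 ⟩
      0# * (m * m - g) - (1# + 1#) * 0# * m
        ≡⟨ solve 2 (λ δ m → con 0ℤ :* δ :- (con 1ℤ :+ con 1ℤ) :* con 0ℤ :* m := con 0ℤ) refl (m * m - g) m ⟩
      0#                                                 ∎)
    ... | inj₁ 2g≡0 = ⊥-elim (x≢0∧y≢0⇒x*y≢0 2≢0 g≢0 2g≡0)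
    ... | inj₂ u₀≡0 = u₀≡0

    second-point≡first⇒k≡0 : 1# + 1# ≢ 0# → g ≢ 0# → ∀ {k} → v₀ * v₀ ≡ g * u₀ * u₀ + k →
                             u₀ + W ≡ u₀ → - v₀ + m * W ≡ v₀ → k ≡ 0#
    second-point≡first⇒k≡0 2≢0 g≢0 {k} on-ellipse u≡u₀ v≡v₀ = begin
      k                    ≡⟨ solve 2 (λ g k → k := g :* con 0ℤ :* con 0ℤ :+ k) refl g k ⟩
      g * 0# * 0# + k      ≡⟨ cong (λ z → g * z * z + k) u₀≡0 ⟨
      g * u₀ * u₀ + k      ≡⟨ on-ellipse ⟨
      v₀ * v₀              ≡⟨ cong (λ z → z * z) v₀≡0 ⟩
      0# * 0#              ≡⟨ zeroˡ 0# ⟩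
      0#                   ∎
      where
      W≡0 = x+y≡x⇒y≡0 u₀ W u≡u₀
      v₀≡0 = second-point≡first⇒v₀≡0 2≢0 W≡0 v≡v₀
      u₀≡0 = second-point≡first⇒u₀≡0 2≢0 g≢0 W≡0 v₀≡0

module Nikodym {q : ℕ} (F : FiniteField q) {n : ℕ} (S : List (Vec (FiniteField.Carrier F) n)) where

  open Field F
  open Univariate F
  open Forms F
  open Geometry F
  open Conics F
  open ≡-Reasoning

  vanishes-at-hyperbola-point : ∀ {d} (P : Form n d) → 2 ℕ.+ d ℕ.* 2 < q → VanishesOn S P →
    ∀ a b c x → LinIndep b c → OnHyperbola a b c x → PuncturedIn (OnHyperbola a b c) x S → ⟦ P ⟧ 1# x ≡ 0#
  vanishes-at-hyperbola-point {d} P bound P|S≡0 a b c x b,c-independent (t₀ , s₀ , t₀s₀≡1 , x≡) H∖x⊆S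
    with x*y≡0⇒x≡0⊎y≡0 _ _ (trans (sym (⟦⟧-along-hyperbola P a b c t₀ s₀ t₀s₀≡1)) (proj₂ restriction≡0 t₀))
    where
    vanishes : ∀ t → t ∉ t₀ ∷ 0# ∷ [] → ⟦ P ⟧ (0# + t * 1# + t * t * 0#) (conic c a b t) ≡ 0#
    vanishes t t∉E = begin
      ⟦ P ⟧ (0# + t * 1# + t * t * 0#) (conic c a b t)
        ≡⟨ ⟦⟧-along-hyperbola P a b c t t⁻¹ t*t⁻¹≡1 ⟩
      t ^ d * ⟦ P ⟧ 1# point
        ≡⟨ cong (t ^ d *_) (P|S≡0 point (H∖x⊆S point (t , t⁻¹ , t*t⁻¹≡1 , refl) point≢x)) ⟩
      t ^ d * 0#
        ≡⟨ zeroʳ _ ⟩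
      0#                                              ∎
      where
      t≢0 : t ≢ 0#
      t≢0 t≡0 = t∉E (there (here t≡0))
      t⁻¹ = proj₁ (inverse t t≢0)
      t*t⁻¹≡1 = proj₂ (inverse t t≢0)
      point = (a ⊕ (t · b)) ⊕ (t⁻¹ · c)
      point≢x : point ≢ x
      point≢x point≡x = t∉E (here (proj₁ (plane-injective a b c b,c-independent (trans point≡x x≡))))
    restriction≡0 = PolyFn-vanishing (t₀ ∷ 0# ∷ []) bound (PolyFn-restriction P 0# 1# 0# c a b) vanishes
  ... | inj₁ t₀^d≡0 = ⊥-elim (x≢0⇒x^n≢0 d t₀≢0 t₀^d≡0)
    where
    t₀≢0 : t₀ ≢ 0#
    t₀≢0 t₀≡0 = 0≢1 (trans (sym (zeroˡ s₀)) (trans (cong (_* s₀) (sym t₀≡0)) t₀s₀≡1))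
  ... | inj₂ P[x]≡0 = trans (cong (⟦ P ⟧ 1#) x≡) P[x]≡0

  vanishes-at-parabola-point : ∀ {d} (P : Form n d) → 1 ℕ.+ d ℕ.* 2 < q → VanishesOn S P →
    ∀ a b c x → LinIndep b c → OnParabola a b c x → PuncturedIn (OnParabola a b c) x S → ⟦ P ⟧ 1# x ≡ 0#
  vanishes-at-parabola-point P bound P|S≡0 a b c x b,c-independent (t₀ , x≡) P∖x⊆S =
    trans (cong (⟦ P ⟧ 1#) x≡) (trans (sym (⟦⟧-along-parabola P a b c t₀)) (proj₂ restriction≡0 t₀))
    where
    vanishes : ∀ t → t ∉ t₀ ∷ [] → ⟦ P ⟧ (1# + t * 0# + t * t * 0#) (conic a b c t) ≡ 0#
    vanishes t t∉E = trans (⟦⟧-along-parabola P a b c t) (P|S≡0 _ (P∖x⊆S _ (t , refl) point≢x))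
      where
      point≢x : conic a b c t ≢ x
      point≢x point≡x = t∉E (here (proj₁ (plane-injective a b c b,c-independent (trans point≡x x≡))))
    restriction≡0 = PolyFn-vanishing (t₀ ∷ []) bound (PolyFn-restriction P 1# 0# 0# a b c) vanishes

  chord-weight : ∀ g m → - g + m * 0# + m * m * 1# ≡ (m * m - g) * 1#
  chord-weight = solve 2 (λ g m → :- g :+ m :* con 0ℤ :+ m :* m :* con 1ℤ := (m :* m :- g) :* con 1ℤ) refl

  -- Cleared of the denominator m² - g, the second intersection point of the chord of slope m
  -- is a conic in m whose leading coefficient is the base point (u₀, v₀).
  chord-conic : ∀ {g u₀ v₀ m W} → W * (m * m - g) ≡ (1# + 1#) * (g * u₀ + v₀ * m) → ∀ (a b c : Pt n) →
    conic (combine (- g) (g * u₀) (g * v₀) a b c)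
          (combine 0# ((1# + 1#) * v₀) ((1# + 1#) * g * u₀) a b c)
          (combine 1# u₀ v₀ a b c) m
      ≡ (m * m - g) · ((a ⊕ ((u₀ + W) · b)) ⊕ ((- v₀ + m * W) · c))
  chord-conic {g} {u₀} {v₀} {m} {W} W-def a b c = begin
    conic (combine (- g) (g * u₀) (g * v₀) a b c)
          (combine 0# ((1# + 1#) * v₀) ((1# + 1#) * g * u₀) a b c)
          (combine 1# u₀ v₀ a b c) m
      ≡⟨ conic-combine (- g) 0# 1# (g * u₀) ((1# + 1#) * v₀) u₀ (g * v₀) ((1# + 1#) * g * u₀) v₀ a b c m ⟩
    combine (- g + m * 0# + m * m * 1#)
            (g * u₀ + m * ((1# + 1#) * v₀) + m * m * u₀)
            (g * v₀ + m * ((1# + 1#) * g * u₀) + m * m * v₀) a b c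
      ≡⟨ cong₂ (λ β γ → combine (- g + m * 0# + m * m * 1#) β γ a b c) (chord-u-scaled W-def) (chord-v-scaled W-def) ⟩
    combine (- g + m * 0# + m * m * 1#) ((m * m - g) * (u₀ + W)) ((m * m - g) * (- v₀ + m * W)) a b c
      ≡⟨ cong (λ α → combine α ((m * m - g) * (u₀ + W)) ((m * m - g) * (- v₀ + m * W)) a b c) (chord-weight g m) ⟩
    combine ((m * m - g) * 1#) ((m * m - g) * (u₀ + W)) ((m * m - g) * (- v₀ + m * W)) a b c
      ≡⟨ plane≡combine (m * m - g) (u₀ + W) (- v₀ + m * W) a b c ⟨
    (m * m - g) · ((a ⊕ ((u₀ + W) · b)) ⊕ ((- v₀ + m * W) · c)) ∎
    where open EllipseChord F

  vanishes-at-ellipse-point : ∀ {d} (P : Form n d) → d ℕ.* 2 < q → VanishesOn S P → ∀ g → NonSquare g →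
    ∀ k → k ≢ 0# → ∀ a b c x → LinIndep b c → OnEllipse g k a b c x → PuncturedIn (OnEllipse g k a b c) x S →
    ⟦ P ⟧ 1# x ≡ 0#
  vanishes-at-ellipse-point {d} P bound P|S≡0 g g-nonSquare k k≢0 a b c x b,c-independent
                            (u₀ , v₀ , on-ellipse , x≡) E∖x⊆S =
    trans (cong (⟦ P ⟧ 1#) (trans x≡ (sym (combine-1 u₀ v₀ a b c)))) (proj₁ restriction≡0)
    where
    open EllipseChord F
    W : Carrier → Carrier
    W m = proj₁ (chord-parameter g-nonSquare u₀ v₀ m)
    W-def = λ m → proj₂ (chord-parameter g-nonSquare u₀ v₀ m)
    point : Carrier → Pt n
    point m = (a ⊕ ((u₀ + W m) · b)) ⊕ ((- v₀ + m * W m) · c)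
    point∈S : ∀ m → point m ∈ S
    point∈S m = E∖x⊆S (point m) (u₀ + W m , - v₀ + m * W m , chord-on-ellipse (W-def m) on-ellipse , refl) point≢x
      where
      point≢x : point m ≢ x
      point≢x point≡x with plane-injective a b c b,c-independent (trans point≡x x≡)
      ... | u≡u₀ , v≡v₀ = k≢0 (second-point≡first⇒k≡0 (W-def m) (nonSquare⇒2≢0 g-nonSquare)
                                 (nonSquare⇒≢0 g-nonSquare) on-ellipse u≡u₀ v≡v₀)
    A′ = combine (- g) (g * u₀) (g * v₀) a b c
    B′ = combine 0# ((1# + 1#) * v₀) ((1# + 1#) * g * u₀) a b c
    C′ = combine 1# u₀ v₀ a b c
    vanishes : ∀ m → m ∉ [] → ⟦ P ⟧ (- g + m * 0# + m * m * 1#) (conic A′ B′ C′ m) ≡ 0#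
    vanishes m _ = begin
      ⟦ P ⟧ (- g + m * 0# + m * m * 1#) (conic A′ B′ C′ m)
        ≡⟨ cong₂ ⟦ P ⟧ (chord-weight g m) (chord-conic (W-def m) a b c) ⟩
      ⟦ P ⟧ ((m * m - g) * 1#) ((m * m - g) · point m)
        ≡⟨ ⟦⟧-homogeneous P (m * m - g) 1# (point m) ⟩
      (m * m - g) ^ d * ⟦ P ⟧ 1# (point m)
        ≡⟨ cong ((m * m - g) ^ d *_) (P|S≡0 (point m) (point∈S m)) ⟩
      (m * m - g) ^ d * 0#
        ≡⟨ zeroʳ _ ⟩
      0#                                               ∎
    restriction≡0 = PolyFn-vanishing [] bound (PolyFn-restriction P (- g) 0# 1# A′ B′ C′) vanishes

module PolynomialMethod {q : ℕ} (F : FiniteField q) {n : ℕ} (S : List (Vec (FiniteField.Carrier F) n)) where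

  open Field F
  open Forms F
  open Geometry F
  open Interpolation F using (interpolate)
  open Kakeya F S using (vanishes-everywhere)
  open Nikodym F S

  monomialCount≤length : ∀ {d} → d < q → (∀ (P : Form n d) → VanishesOn S P → ∀ y → ⟦ P ⟧ 1# y ≡ 0#) →
                         monomialCount n d ≤ length S
  monomialCount≤length {d} d<q forces-vanishing with monomialCount n d ℕ.≤? length S
  ... | yes count≤|S| = count≤|S|
  ... | no count≰|S|  = ⊥-elim (P≢0 (vanishing⇒isZero d<q P (forces-vanishing P P|S≡0)))
    where
    P   = proj₁ (interpolate n d S (ℕ.≰⇒> count≰|S|))
    P≢0 = proj₁ (proj₂ (interpolate n d S (ℕ.≰⇒> count≰|S|)))
    P|S≡0 : VanishesOn S P
    P|S≡0 s s∈S = All.lookup (proj₂ (proj₂ (interpolate n d S (ℕ.≰⇒> count≰|S|)))) s∈S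

  private
    <-of-bound : ∀ {d} → 2 ℕ.+ d ℕ.* 2 < q → d < q
    <-of-bound {d} = ℕ.≤-trans (s≤s (ℕ.≤-trans (ℕ.m≤m*n d 2) (ℕ.m≤n+m (d ℕ.* 2) 2)))

  nonzero-point : ∀ {m} → 1 ≤ m → Σ (Pt m) (_≢ 𝟎)
  nonzero-point {suc m} _ = 1# ∷ 𝟎 , 0≢1 ∘ sym ∘ Vec.∷-injectiveˡ

  kakeya-bound : ConicalKakeya S → 1 ≤ n → ∀ {d} → 2 ℕ.+ d ℕ.* 2 < q → monomialCount n d ≤ length S
  kakeya-bound kakeya 1≤n {d} bound = monomialCount≤length (<-of-bound bound)
    (λ P → vanishes-everywhere kakeya (proj₂ point∈S) (ℕ.<⇒≤ bound) P)
    where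
    point∈S : Σ (Pt n) (_∈ S)
    point∈S with kakeya (proj₁ (nonzero-point 1≤n)) (proj₂ (nonzero-point 1≤n))
    ... | a , b , c , _ , inj₁ (_ , H⊆S) = _ , H⊆S _ (1# , 1# , *-identityˡ 1# , refl)
    ... | a , b , c , _ , inj₂ (_ , P⊆S) = _ , P⊆S _ (0# , refl)

  nikodym-bound : ∀ g → NonSquare g → ConicalNikodym g S → ∀ {d} → 2 ℕ.+ d ℕ.* 2 < q →
                  monomialCount n d ≤ length S
  nikodym-bound g g-nonSquare nikodym {d} bound = monomialCount≤length (<-of-bound bound) vanishes
    where
    vanishes : ∀ (P : Form n d) → VanishesOn S P → ∀ y → ⟦ P ⟧ 1# y ≡ 0#
    vanishes P P|S≡0 y with nikodym y
    ... | a , b , c , indep , inj₁ (on , H∖y⊆S) =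
      vanishes-at-hyperbola-point P bound P|S≡0 a b c y indep on H∖y⊆S
    ... | a , b , c , indep , inj₂ (inj₁ (on , P∖y⊆S)) =
      vanishes-at-parabola-point P (ℕ.<⇒≤ bound) P|S≡0 a b c y indep on P∖y⊆S
    ... | a , b , c , indep , inj₂ (inj₂ (k , k≢0 , on , E∖y⊆S)) =
      vanishes-at-ellipse-point P (ℕ.≤-trans (ℕ.n≤1+n _) (ℕ.<⇒≤ bound)) P|S≡0 g g-nonSquare k k≢0
                                a b c y indep on E∖y⊆S

open import Data.Nat using (_*_; _^_; _∸_; _≥_)
open MonomialCount using (monomialCount≤⇒[2+2d]^n≤[2n]^n*)
open OddNumbers using (oddPrimePower⇒≡3+d*2)

theorem1 : (q : ℕ) → OddPrimePower q → (F : FiniteField q) → (n : ℕ) → n ≥ 2 →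
    (g : FiniteField.Carrier F) → Geometry.NonSquare F g →
    (S : List (Geometry.Pt F n)) → Unique S →
    (Geometry.ConicalKakeya F S ⊎ Geometry.ConicalNikodym F g S) →
    (q ∸ 1) ^ n ≤ (2 * n) ^ n * length S
theorem1 q q-oddPrimePower F n n≥2 g g-nonSquare S _ kakeya⊎nikodym =
  subst (λ m → m ^ n ≤ (2 * n) ^ n * length S) (sym q∸1≡2[1+d])
    (monomialCount≤⇒[2+2d]^n≤[2n]^n* n d (length S) count≤|S|)
  where
  open PolynomialMethod F S
  d = proj₁ (oddPrimePower⇒≡3+d*2 q-oddPrimePower)
  q≡3+d*2 = proj₂ (oddPrimePower⇒≡3+d*2 q-oddPrimePower)
  2+d*2<q : 2 ℕ.+ d * 2 < q
  2+d*2<q = ℕ.≤-reflexive (sym q≡3+d*2)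
  count≤|S| : monomialCount n d ≤ length S
  count≤|S| = [ (λ kakeya → kakeya-bound kakeya (ℕ.≤-trans (s≤s z≤n) n≥2) 2+d*2<q)
              , (λ nikodym → nikodym-bound g g-nonSquare nikodym 2+d*2<q) ]′ kakeya⊎nikodym
  q∸1≡2[1+d] : q ∸ 1 ≡ 2 * suc d
  q∸1≡2[1+d] = trans (cong (_∸ 1) q≡3+d*2) (ℕ.*-comm (suc d) 2)
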